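{- Let $k\ge 1$ and $n\ge 1$ be integers, let $\mathcal{V}\subseteq\{0,1,\dots,k-1\}^n\subseteq\mathbb{Q}^n$ be a finite point set, and let $\prec$ be the lexicographic order on the monomials of $\mathbb{Q}[x_1,\dots,x_n]$ for which $x_{i_1}\succ x_{i_2}\succ\dots\succ x_{i_n}$, where $(i_1,\dots,i_n)$ is a permutation of $[n]$. Then $$\mathrm{Sm}(I(\mathcal{V}))=D_{i_n,i_{n-1},\dots,i_1}(\mathcal{V}),$$ where standard monomials are taken with respect to $\prec$ and a monomial $x^{\mathbf w}=x_1^{w_1}\cdots x_n^{w_n}$ is identified with its exponent vector $\mathbf w\in\mathbb{Z}_{\ge0}^n$.
   Context: For a finite set $\mathcal{V}\subseteq\mathbb{F}^n$ ($\mathbb{F}$ a field), the vanishing ideal is $I(\mathcal{V})=\{f\in\mathbb{F}[x_1,\dots,x_n]: f(\mathbf v)=0\ \forall \mathbf v\in\mathcal{V}\}$. A term order is a total order on monomials with $1$ minimal and compatible with multiplication by monomials. The lexicographic order with $x_{i_1}\succ\dots\succ x_{i_n}$: $x^{\mathbf w}\prec x^{\mathbf u}$ iff for the smallest $j$ with $w_{i_j}\ne u_{i_j}$ one has $w_{i_j}<u_{i_j}$. For a nonzero polynomial $f$, its leading monomial is the $\prec$-largest monomial with nonzero coefficient in $f$; a monomial is a standard monomial of an ideal $I$ if it is not the leading monomial of any nonzero $f\in I$; $\mathrm{Sm}(I)$ denotes the set of standard monomials. For $\mathcal{V}\subseteq\{0,\dots,k-1\}^n$ and $i\in[n]$, the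 $i$-section at $(\alpha_1,\dots,\alpha_{i-1},\alpha_{i+1},\dots,\alpha_n)$ is $\mathcal{V}_i(\alpha_1,\dots,\alpha_{i-1},\alpha_{i+1},\dots,\alpha_n)=\{\alpha:(\alpha_1,\dots,\alpha_{i-1},\alpha,\alpha_{i+1},\dots,\alpha_n)\in\mathcal{V}\}$. The downshift $D_i(\mathcal{V})$ is the unique subset of $\{0,\dots,k-1\}^n$ whose $i$-section at each $(\alpha_1,\dots,\alpha_{i-1},\alpha_{i+1},\dots,\alpha_n)$ equals $\{0,1,\dots,|\mathcal{V}_i(\alpha_1,\dots,\alpha_{i-1},\alpha_{i+1},\dots,\alpha_n)|-1\}$ when that section of $\mathcal{V}$ is nonempty, and is empty otherwise. For indices $j_1,\dots,j_\ell$, $D_{j_1,j_2,\dots,j_\ell}(\mathcal{V}):=D_{j_1}(D_{j_2}(\cdots(D_{j_\ell}(\mathcal{V}))))$. -}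

module Defs where

open import Data.Nat as ℕ using (ℕ; zero; suc; _<_; _<ᵇ_)
open import Data.Fin using (Fin; toℕ)
open import Data.Fin.Permutation using (Permutation′; _⟨$⟩ʳ_)
open import Data.Bool using (Bool; true; false; if_then_else_)
open import Data.List as List using (List; []; _∷_; filter; length; upTo; allFin; reverse)
open import Data.Vec as Vec using (Vec; lookup; _[_]≔_)
open import Data.Vec.Properties using (≡-dec)
open import Data.Product using (_×_; _,_; Σ; ∃)
open import Data.Rational using (ℚ; 0ℚ; 1ℚ; _+_; _*_)
open import Relation.Nullary using (¬_; Dec; yes; no)
open import Relation.Nullary.Decidable using (does)
open import Relation.Binary.PropositionalEquality using (_≡_; _≢_)

Monomial : ℕ → Set
Monomial n = Vec ℕ n

-- A polynomial in ℚ[x_1..x_n] is a finite formal sum of terms c·x^w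
-- (repeated monomials allowed; their coefficients add up).
Poly : ℕ → Set
Poly n = List (ℚ × Monomial n)

coeff : ∀ {n} → Poly n → Monomial n → ℚ
coeff [] w = 0ℚ
coeff ((c , u) ∷ f) w =
  if does (≡-dec ℕ._≟_ u w) then c + coeff f w else coeff f w

pow : ℚ → ℕ → ℚ
pow a zero = 1ℚ
pow a (suc e) = a * pow a e

evalMon : ∀ {n} → Vec ℚ n → Monomial n → ℚ
evalMon Vec.[] Vec.[] = 1ℚ
evalMon (a Vec.∷ as) (e Vec.∷ es) = pow a e * evalMon as es

eval : ∀ {n} → Poly n → Vec ℚ n → ℚ
eval [] a = 0ℚ
eval ((c , w) ∷ f) a = c * evalMon a w + eval f a

toℚⁿ : ∀ {n} → Vec ℕ n → Vec ℚ n
toℚⁿ = Vec.map (λ m → Data.Integer.+ m Data.Rational./ 1)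
  where import Data.Integer
        import Data.Rational

PointSet : ℕ → Set
PointSet n = Vec ℕ n → Bool

InBox : ∀ {n} → ℕ → PointSet n → Set
InBox {n} k V = ∀ (p : Vec ℕ n) → V p ≡ true → ∀ (i : Fin n) → lookup p i < k

InVanishingIdeal : ∀ {n} → PointSet n → Poly n → Set
InVanishingIdeal {n} V f = ∀ (p : Vec ℕ n) → V p ≡ true → eval f (toℚⁿ p) ≡ 0ℚ

-- lexicographic order with x_{σ(0)} ≻ x_{σ(1)} ≻ … ≻ x_{σ(n-1)}:
-- w ≺ u iff at the first position j (in the order σ) where they differ, w < u.
LexLt : ∀ {n} → Permutation′ n → Monomial n → Monomial n → Set
LexLt {n} σ w u =
  Σ (Fin n) λ j →
    (∀ (j' : Fin n) → toℕ j' < toℕ j → lookup w (σ ⟨$⟩ʳ j') ≡ lookup u (σ ⟨$⟩ʳ j'))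
    × (lookup w (σ ⟨$⟩ʳ j) < lookup u (σ ⟨$⟩ʳ j))

IsLeadingMonomial : ∀ {n} → Permutation′ n → Poly n → Monomial n → Set
IsLeadingMonomial {n} σ f w =
  (coeff f w ≢ 0ℚ) × (∀ (u : Monomial n) → LexLt σ w u → coeff f u ≡ 0ℚ)

IsStandardMonomial : ∀ {n} → Permutation′ n → PointSet n → Monomial n → Set
IsStandardMonomial σ V w =
  ¬ (∃ λ f → InVanishingIdeal V f × IsLeadingMonomial σ f w)

sectionSize : ∀ {n} → ℕ → Fin n → PointSet n → Vec ℕ n → ℕ
sectionSize k i V w = length (filter (λ α → V (w [ i ]≔ α) Data.Bool.≟ true) (upTo k))
  where import Data.Bool

-- downshift D_i (for sets inside {0..k-1}^n)
downshift : ∀ {n} → ℕ → Fin n → PointSet n → PointSet n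
downshift k i V w = lookup w i <ᵇ sectionSize k i V w

downshifts : ∀ {n} → ℕ → List (Fin n) → PointSet n → PointSet n
downshifts k [] V = V
downshifts k (j ∷ js) V = downshift k j (downshifts k js V)

-- the index list (i_n, i_{n-1}, …, i_1) where i_{j+1} = σ(j)
reversedOrder : ∀ {n} → Permutation′ n → List (Fin n)
reversedOrder {n} σ = reverse (List.map (σ ⟨$⟩ʳ_) (allFin n))

module Submission where

-- Let x_{i_1} ≻ ⋯ ≻ x_{i_n}. For 0 ≤ m ≤ n let cut_m be w with the exponents of x_{i_1}, …, x_{i_m}
-- set to 0, and 𝒰_m the set of points p which, after replacing their coordinates i_1, …, i_m by those
-- of w, lie in D_{i_m,…,i_1}(𝒱). Call g an m-witness if g vanishes on 𝒰_m and has leading monomial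
-- cut_m. A 0-witness is an element of I(𝒱) with leading monomial w, and an n-witness, a nonzero
-- constant, exists iff w ∉ D_{i_n,…,i_1}(𝒱); so it suffices that m- and (m+1)-witnesses exist
-- together. Let c = i_{m+1} and d = w_c.
-- Down: the coefficient of x_c^d in an m-witness f is an (m+1)-witness: through a point of 𝒰_{m+1}
-- the line in direction x_c meets 𝒰_m in more than d points, and f has degree ≤ d in x_c there.
-- Up: for an (m+1)-witness g, g·(x_c^d + R) is an m-witness, where R interpolates, in the variables
-- less significant than x_c, the lower-order part of x_c^{d−|F|} ∏_{α ∈ F} (x_c − α), F being the
-- line of 𝒰_m through the point; on 𝒰_m ∖ 𝒰_{m+1} we have |F| ≤ d, so the second factor vanishes.

open import Defs
open import Data.Nat using (ℕ; _≥_)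
open import Data.Bool using (true)
open import Data.Fin.Permutation using (Permutation′)
open import Relation.Binary.PropositionalEquality using (_≡_)
open import Function.Bundles using (_⇔_)

open import Data.Nat as ℕ using (zero; suc; _<_; _≤_; s≤s)
import Data.Nat.Properties as ℕP
import Data.Nat.GCD as ℕGCD
import Data.Integer as ℤ
import Data.Integer.Properties as ℤP
open import Data.Fin as Fin using (Fin; toℕ; fromℕ<)
import Data.Fin.Properties as FinP
open import Data.Fin.Permutation using (_⟨$⟩ʳ_; _⟨$⟩ˡ_; inverseʳ; inverseˡ)
open import Data.Bool using (Bool; false; if_then_else_; T)
import Data.Bool as Bool
open import Data.List as List
  using (List; []; _∷_; _++_; filter; length; concatMap; upTo; downFrom; allFin; reverse; applyDownFrom; applyUpTo)
import Data.List.Properties as ListP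
open import Data.List.Relation.Unary.All as All using (All; []; _∷_)
open import Data.List.Relation.Unary.AllPairs using (AllPairs; []; _∷_)
open import Data.List.Relation.Unary.Any using (here; there)
open import Data.List.Membership.Propositional using (_∈_)
import Data.List.Membership.Propositional.Properties as ∈P
import Data.List.Relation.Unary.Unique.Propositional.Properties as UniqueP
open import Data.Vec as Vec using (Vec; lookup; _[_]≔_; tabulate; zipWith; replicate)
import Data.Vec.Properties as VecP
open import Data.Product using (_×_; _,_; Σ; ∃; proj₁; proj₂)
open import Data.Sum using (_⊎_; inj₁; inj₂)
open import Data.Empty using (⊥; ⊥-elim)
open import Data.Unit using (tt)
open import Data.Rational as ℚ using (ℚ; 0ℚ; 1ℚ; _+_; _*_; _-_; -_)
import Data.Rational.Properties as ℚP
open import Data.Rational.Solver using (module +-*-Solver)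
open import Function using (_∘_)
open import Function.Bundles using (mk⇔)
open import Relation.Nullary using (¬_; Dec; yes; no)
open import Relation.Nullary.Decidable using (does; dec-true; dec-false)
open import Relation.Binary.Definitions using (tri<; tri≈; tri>)
open import Relation.Binary.PropositionalEquality
  using (_≢_; refl; sym; trans; cong; cong₂; subst; subst₂; module ≡-Reasoning)

open +-*-Solver using (solve; _:=_; _:+_; _:*_; _:-_; :-_; con)

toℚ : ℕ → ℚ
toℚ m = ℤ.+ m ℚ./ 1

toℚ-injective : ∀ {a b} → toℚ a ≡ toℚ b → a ≡ b
toℚ-injective {a} {b} eq = ℤP.+-injective (trans (sym (↥toℚ a)) (trans (cong ℚ.↥_ eq) (↥toℚ b)))
  where
  ↥toℚ : ∀ m → ℚ.↥ (toℚ m) ≡ ℤ.+ m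
  ↥toℚ m = trans (sym (ℤP.*-identityʳ (ℚ.↥ (toℚ m))))
    (trans (cong (λ g → ℚ.↥ (toℚ m) ℤ.* ℤ.+ g) (sym (ℕGCD.gcd-zeroʳ m))) (ℚP.↥-/ (ℤ.+ m) 1))

x-y≡0⇒x≡y : ∀ x y → x - y ≡ 0ℚ → x ≡ y
x-y≡0⇒x≡y x y eq = begin
  x             ≡⟨ solve 2 (λ x y → x := (x :- y) :+ y) refl x y ⟩
  (x - y) + y   ≡⟨ cong (_+ y) eq ⟩
  0ℚ + y        ≡⟨ ℚP.+-identityˡ y ⟩
  y             ∎
  where open ≡-Reasoning

x*y≡0⇒y≡0 : ∀ x y → x ≢ 0ℚ → x * y ≡ 0ℚ → y ≡ 0ℚ
x*y≡0⇒y≡0 x y x≢0 xy≡0 = begin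
  y                    ≡⟨ sym (ℚP.*-identityˡ y) ⟩
  1ℚ * y               ≡⟨ cong (_* y) (sym (ℚP.*-inverseˡ x)) ⟩
  (ℚ.1/ x * x) * y     ≡⟨ ℚP.*-assoc (ℚ.1/ x) x y ⟩
  ℚ.1/ x * (x * y)     ≡⟨ cong (ℚ.1/ x *_) xy≡0 ⟩
  ℚ.1/ x * 0ℚ          ≡⟨ ℚP.*-zeroʳ (ℚ.1/ x) ⟩
  0ℚ                   ∎
  where
  open ≡-Reasoning
  instance _ = ℚ.≢-nonZero x≢0

-- The inverse extended by the junk value 0 at 0.
inv₀ : ℚ → ℚ
inv₀ x with x ℚP.≟ 0ℚ
... | yes _ = 0ℚ
... | no x≢0 = ℚ.1/_ x {{ℚ.≢-nonZero x≢0}}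

*-inv₀ : ∀ x → x ≢ 0ℚ → x * inv₀ x ≡ 1ℚ
*-inv₀ x x≢0 with x ℚP.≟ 0ℚ
... | yes x≡0 = ⊥-elim (x≢0 x≡0)
... | no x≢0′ = ℚP.*-inverseʳ x {{ℚ.≢-nonZero x≢0′}}

pow-+ : ∀ x s t → pow x (s ℕ.+ t) ≡ pow x s * pow x t
pow-+ x zero t = sym (ℚP.*-identityˡ (pow x t))
pow-+ x (suc s) t = trans (cong (x *_) (pow-+ x s t)) (sym (ℚP.*-assoc x (pow x s) (pow x t)))

lookup-ext : ∀ {A : Set} {n} {u v : Vec A n} → (∀ i → lookup u i ≡ lookup v i) → u ≡ v
lookup-ext {u = u} {v} eq =
  trans (sym (VecP.tabulate∘lookup u)) (trans (VecP.tabulate-cong eq) (VecP.tabulate∘lookup v))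

lookup-[]≔ : ∀ {A : Set} {n} (u : Vec A n) c x i →
  lookup (u [ c ]≔ x) i ≡ (if does (i Fin.≟ c) then x else lookup u i)
lookup-[]≔ u c x i with i Fin.≟ c
... | yes refl = VecP.lookup∘update i u x
... | no i≢c = VecP.lookup∘update′ i≢c u x

-- Monomials and polynomials

𝟙 : ∀ {n} → Monomial n
𝟙 {n} = replicate n 0

_⊕_ : ∀ {n} → Monomial n → Monomial n → Monomial n
_⊕_ = zipWith ℕ._+_

lookup-⊕ : ∀ {n} (u v : Monomial n) i → lookup (u ⊕ v) i ≡ lookup u i ℕ.+ lookup v i
lookup-⊕ u v i = VecP.lookup-zipWith ℕ._+_ i u v

𝟙-⊕ : ∀ {n} (v : Monomial n) → 𝟙 ⊕ v ≡ v
𝟙-⊕ v = lookup-ext λ i → trans (lookup-⊕ 𝟙 v i) (cong (ℕ._+ lookup v i) (VecP.lookup-replicate i 0))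

⊕-cancelʳ : ∀ {n} (u v e : Monomial n) → u ⊕ e ≡ v ⊕ e → u ≡ v
⊕-cancelʳ u v e eq = lookup-ext λ i → ℕP.+-cancelʳ-≡ (lookup e i) (lookup u i) (lookup v i)
  (trans (sym (lookup-⊕ u e i)) (trans (cong (λ z → lookup z i) eq) (lookup-⊕ v e i)))

x^ : ∀ {n} → Fin n → ℕ → Monomial n
x^ c t = 𝟙 [ c ]≔ t

lookup-x^ : ∀ {n} (c : Fin n) t → lookup (x^ c t) c ≡ t
lookup-x^ c t = VecP.lookup∘update c 𝟙 t

⊕-x^ : ∀ {n} (u : Monomial n) c d → lookup u c ≡ 0 → u ⊕ x^ c d ≡ u [ c ]≔ d
⊕-x^ u c d uc≡0 = lookup-ext λ i → trans (lookup-⊕ u (x^ c d) i) (trans (entry i) (sym (lookup-[]≔ u c d i)))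
  where
  entry : ∀ i → lookup u i ℕ.+ lookup (x^ c d) i ≡ (if does (i Fin.≟ c) then d else lookup u i)
  entry i with i Fin.≟ c
  ... | yes refl = cong₂ ℕ._+_ uc≡0 (lookup-x^ c d)
  ... | no i≢c = trans (cong (lookup u i ℕ.+_) (trans (VecP.lookup∘update′ i≢c 𝟙 d) (VecP.lookup-replicate i 0)))
                       (ℕP.+-identityʳ _)

evalMon-⊕ : ∀ {n} (a : Vec ℚ n) u v → evalMon a (u ⊕ v) ≡ evalMon a u * evalMon a v
evalMon-⊕ Vec.[] Vec.[] Vec.[] = refl
evalMon-⊕ (x Vec.∷ a) (s Vec.∷ u) (t Vec.∷ v) =
  trans (cong₂ _*_ (pow-+ x s t) (evalMon-⊕ a u v))
    (solve 4 (λ p q r s → (p :* q) :* (r :* s) := (p :* r) :* (q :* s)) refl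
       (pow x s) (pow x t) (evalMon a u) (evalMon a v))

evalMon-𝟙 : ∀ {n} (a : Vec ℚ n) → evalMon a 𝟙 ≡ 1ℚ
evalMon-𝟙 Vec.[] = refl
evalMon-𝟙 (x Vec.∷ a) = trans (ℚP.*-identityˡ _) (evalMon-𝟙 a)

evalMon-x^ : ∀ {n} (a : Vec ℚ n) c t → evalMon a (x^ c t) ≡ pow (lookup a c) t
evalMon-x^ (x Vec.∷ a) Fin.zero t = trans (cong (pow x t *_) (evalMon-𝟙 a)) (ℚP.*-identityʳ _)
evalMon-x^ (x Vec.∷ a) (Fin.suc c) t = trans (ℚP.*-identityˡ _) (evalMon-x^ a c t)

evalMon-[]≔ : ∀ {n} (a : Vec ℚ n) u c x → evalMon (a [ c ]≔ x) u ≡ pow x (lookup u c) * evalMon a (u [ c ]≔ 0)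
evalMon-[]≔ (y Vec.∷ a) (e Vec.∷ u) Fin.zero x = cong (pow x e *_) (sym (ℚP.*-identityˡ _))
evalMon-[]≔ (y Vec.∷ a) (e Vec.∷ u) (Fin.suc c) x =
  trans (cong (pow y e *_) (evalMon-[]≔ a u c x))
    (solve 3 (λ p q r → p :* (q :* r) := q :* (p :* r)) refl (pow y e) (pow x (lookup u c)) (evalMon a (u [ c ]≔ 0)))

term : ∀ {n} → ℚ → Monomial n → Poly n
term c u = (c , u) ∷ []

eval-term : ∀ {n} c (u : Monomial n) a → eval (term c u) a ≡ c * evalMon a u
eval-term c u a = ℚP.+-identityʳ _

coeff-term : ∀ {n} c (u : Monomial n) → coeff (term c u) u ≡ c
coeff-term c u with VecP.≡-dec ℕ._≟_ u u
... | yes _ = ℚP.+-identityʳ c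
... | no u≢u = ⊥-elim (u≢u refl)

eval-++ : ∀ {n} (f g : Poly n) a → eval (f ++ g) a ≡ eval f a + eval g a
eval-++ [] g a = sym (ℚP.+-identityˡ _)
eval-++ ((c , u) ∷ f) g a =
  trans (cong (c * evalMon a u +_) (eval-++ f g a)) (sym (ℚP.+-assoc (c * evalMon a u) (eval f a) (eval g a)))

coeff-++ : ∀ {n} (f g : Poly n) w → coeff (f ++ g) w ≡ coeff f w + coeff g w
coeff-++ [] g w = sym (ℚP.+-identityˡ _)
coeff-++ ((c , u) ∷ f) g w with VecP.≡-dec ℕ._≟_ u w
... | yes _ = trans (cong (c +_) (coeff-++ f g w)) (sym (ℚP.+-assoc c (coeff f w) (coeff g w)))
... | no _ = coeff-++ f g w

_*ᵗ_ : ∀ {n} → ℚ × Monomial n → Poly n → Poly n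
(c , u) *ᵗ g = List.map (λ (c′ , u′) → (c * c′ , u ⊕ u′)) g

_*ₚ_ : ∀ {n} → Poly n → Poly n → Poly n
f *ₚ g = concatMap (_*ᵗ g) f

eval-*ᵗ : ∀ {n} c u (g : Poly n) a → eval ((c , u) *ᵗ g) a ≡ c * evalMon a u * eval g a
eval-*ᵗ c u [] a = sym (ℚP.*-zeroʳ (c * evalMon a u))
eval-*ᵗ c u ((c′ , u′) ∷ g) a =
  trans (cong₂ _+_ (cong ((c * c′) *_) (evalMon-⊕ a u u′)) (eval-*ᵗ c u g a))
    (solve 5 (λ c c′ e e′ r → (c :* c′) :* (e :* e′) :+ c :* e :* r := c :* e :* (c′ :* e′ :+ r)) refl
       c c′ (evalMon a u) (evalMon a u′) (eval g a))

eval-*ₚ : ∀ {n} (f g : Poly n) a → eval (f *ₚ g) a ≡ eval f a * eval g a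
eval-*ₚ [] g a = sym (ℚP.*-zeroˡ (eval g a))
eval-*ₚ ((c , u) ∷ f) g a = begin
  eval ((c , u) *ᵗ g ++ f *ₚ g) a              ≡⟨ eval-++ ((c , u) *ᵗ g) (f *ₚ g) a ⟩
  eval ((c , u) *ᵗ g) a + eval (f *ₚ g) a      ≡⟨ cong₂ _+_ (eval-*ᵗ c u g a) (eval-*ₚ f g a) ⟩
  c * evalMon a u * eval g a + eval f a * eval g a ≡⟨ sym (ℚP.*-distribʳ-+ (eval g a) (c * evalMon a u) (eval f a)) ⟩
  (c * evalMon a u + eval f a) * eval g a      ∎
  where open ≡-Reasoning

coeff-*ₚ-monomial : ∀ {n} (g : Poly n) e v → coeff (g *ₚ term 1ℚ e) (v ⊕ e) ≡ coeff g v
coeff-*ₚ-monomial [] e v = refl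
coeff-*ₚ-monomial ((c , u) ∷ g) e v with VecP.≡-dec ℕ._≟_ (u ⊕ e) (v ⊕ e) | VecP.≡-dec ℕ._≟_ u v
... | yes _ | yes _ = cong₂ _+_ (ℚP.*-identityʳ c) (coeff-*ₚ-monomial g e v)
... | yes u⊕e≡v⊕e | no u≢v = ⊥-elim (u≢v (⊕-cancelʳ u v e u⊕e≡v⊕e))
... | no u⊕e≢v⊕e | yes refl = ⊥-elim (u⊕e≢v⊕e refl)
... | no _ | no _ = coeff-*ₚ-monomial g e v

AllMon : ∀ {n} → (Monomial n → Set) → Poly n → Set
AllMon P = All (λ t → P (proj₂ t))

AllMon-++ : ∀ {n} {P : Monomial n → Set} {f g} → AllMon P f → AllMon P g → AllMon P (f ++ g)
AllMon-++ [] pg = pg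
AllMon-++ (pu ∷ pf) pg = pu ∷ AllMon-++ pf pg

AllMon-concatMap : ∀ {n} {A : Set} {P : Monomial n → Set} (h : A → Poly n) xs →
  (∀ x → AllMon P (h x)) → AllMon P (concatMap h xs)
AllMon-concatMap h [] ph = []
AllMon-concatMap h (x ∷ xs) ph = AllMon-++ (ph x) (AllMon-concatMap h xs ph)

module _ {n} {P Q R : Monomial n → Set} (PQ⇒R : ∀ u v → P u → Q v → R (u ⊕ v)) where

  AllMon-*ᵗ : ∀ c u {g} → P u → AllMon Q g → AllMon R ((c , u) *ᵗ g)
  AllMon-*ᵗ c u pu [] = []
  AllMon-*ᵗ c u pu (qv ∷ qg) = PQ⇒R _ _ pu qv ∷ AllMon-*ᵗ c u pu qg

  AllMon-*ₚ : ∀ {f g} → AllMon P f → AllMon Q g → AllMon R (f *ₚ g)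
  AllMon-*ₚ [] qg = []
  AllMon-*ₚ {(c , u) ∷ f} (pu ∷ pf) qg = AllMon-++ (AllMon-*ᵗ c u pu qg) (AllMon-*ₚ pf qg)

AllMon-term-*ₚ : ∀ {n} {Q R : Monomial n → Set} c u {g} →
  (∀ v → Q v → R (u ⊕ v)) → AllMon Q g → AllMon R (term c u *ₚ g)
AllMon-term-*ₚ {Q = Q} c u Q⇒R qg = AllMon-++ (AllMon-*ᵗ {P = _≡ u} {Q = Q} (λ { _ v refl → Q⇒R v }) c u refl qg) []

coeff-absent : ∀ {n} (f : Poly n) w → AllMon (_≢ w) f → coeff f w ≡ 0ℚ
coeff-absent [] w _ = refl
coeff-absent ((c , u) ∷ f) w (u≢w ∷ f≢w) with VecP.≡-dec ℕ._≟_ u w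
... | yes u≡w = ⊥-elim (u≢w u≡w)
... | no _ = coeff-absent f w f≢w

eval-single-monomial : ∀ {n} (f : Poly n) u a → AllMon (_≡ u) f → eval f a ≡ coeff f u * evalMon a u
eval-single-monomial [] u a [] = sym (ℚP.*-zeroˡ (evalMon a u))
eval-single-monomial ((c , u) ∷ f) u a (refl ∷ f≡u) with VecP.≡-dec ℕ._≟_ u u
... | yes _ = trans (cong (c * evalMon a u +_) (eval-single-monomial f u a f≡u))
                    (sym (ℚP.*-distribʳ-+ (evalMon a u) c (coeff f u)))
... | no u≢u = ⊥-elim (u≢u refl)

insertTerm : ∀ {n} → ℚ × Monomial n → Poly n → Poly n
insertTerm (c , u) [] = if does (c ℚP.≟ 0ℚ) then [] else term c u
insertTerm (c , u) ((c′ , u′) ∷ g) =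
  if does (VecP.≡-dec ℕ._≟_ u′ u)
  then (if does ((c + c′) ℚP.≟ 0ℚ) then g else (c + c′ , u) ∷ g)
  else (c′ , u′) ∷ insertTerm (c , u) g

normalise : ∀ {n} → Poly n → Poly n
normalise = List.foldr insertTerm []

eval-insertTerm : ∀ {n} c u (g : Poly n) a → eval (insertTerm (c , u) g) a ≡ c * evalMon a u + eval g a
eval-insertTerm c u [] a with c ℚP.≟ 0ℚ
... | yes refl = sym (trans (ℚP.+-identityʳ _) (ℚP.*-zeroˡ (evalMon a u)))
... | no _ = refl
eval-insertTerm c u ((c′ , u′) ∷ g) a with VecP.≡-dec ℕ._≟_ u′ u
... | yes refl with (c + c′) ℚP.≟ 0ℚ
...   | yes c+c′≡0 = sym (begin
          c * E + (c′ * E + eval g a)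
            ≡⟨ solve 4 (λ c c′ E r → c :* E :+ (c′ :* E :+ r) := (c :+ c′) :* E :+ r) refl c c′ E (eval g a) ⟩
          (c + c′) * E + eval g a     ≡⟨ cong (λ z → z * E + eval g a) c+c′≡0 ⟩
          0ℚ * E + eval g a           ≡⟨ cong (_+ eval g a) (ℚP.*-zeroˡ E) ⟩
          0ℚ + eval g a               ≡⟨ ℚP.+-identityˡ _ ⟩
          eval g a                    ∎)
  where open ≡-Reasoning
        E = evalMon a u
...   | no _ = solve 4 (λ c c′ E r → (c :+ c′) :* E :+ r := c :* E :+ (c′ :* E :+ r)) refl c c′ (evalMon a u) (eval g a)
eval-insertTerm c u ((c′ , u′) ∷ g) a | no _ =
  trans (cong (c′ * evalMon a u′ +_) (eval-insertTerm c u g a))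
    (solve 3 (λ x y r → x :+ (y :+ r) := y :+ (x :+ r)) refl (c′ * evalMon a u′) (c * evalMon a u) (eval g a))

coeff-insertTerm : ∀ {n} c u (g : Poly n) v → coeff (insertTerm (c , u) g) v ≡ coeff ((c , u) ∷ g) v
coeff-insertTerm c u [] v with c ℚP.≟ 0ℚ
... | no _ = refl
... | yes refl with VecP.≡-dec ℕ._≟_ u v
...   | yes _ = refl
...   | no _ = refl
coeff-insertTerm c u ((c′ , u′) ∷ g) v with VecP.≡-dec ℕ._≟_ u′ u
... | yes refl with (c + c′) ℚP.≟ 0ℚ
...   | yes c+c′≡0 with VecP.≡-dec ℕ._≟_ u′ v
...     | yes _ = sym (trans (sym (ℚP.+-assoc c c′ (coeff g v))) (trans (cong (_+ coeff g v) c+c′≡0) (ℚP.+-identityˡ _)))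
...     | no _ = refl
coeff-insertTerm c u ((c′ , u′) ∷ g) v | yes refl | no _ with VecP.≡-dec ℕ._≟_ u′ v
...     | yes _ = ℚP.+-assoc c c′ (coeff g v)
...     | no _ = refl
coeff-insertTerm c u ((c′ , u′) ∷ g) v | no u′≢u
  with VecP.≡-dec ℕ._≟_ u′ v | VecP.≡-dec ℕ._≟_ u v | coeff-insertTerm c u g v
... | yes refl | yes refl | _ = ⊥-elim (u′≢u refl)
... | yes refl | no _ | ih = cong (c′ +_) ih
... | no _ | yes refl | ih = ih
... | no _ | no _ | ih = ih

eval-normalise : ∀ {n} (f : Poly n) a → eval (normalise f) a ≡ eval f a
eval-normalise [] a = refl
eval-normalise ((c , u) ∷ f) a =
  trans (eval-insertTerm c u (normalise f) a) (cong (c * evalMon a u +_) (eval-normalise f a))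

coeff-normalise : ∀ {n} (f : Poly n) v → coeff (normalise f) v ≡ coeff f v
coeff-normalise [] v = refl
coeff-normalise ((c , u) ∷ f) v with VecP.≡-dec ℕ._≟_ u v | coeff-insertTerm c u (normalise f) v
... | yes _ | eq = trans eq (cong (c +_) (coeff-normalise f v))
... | no _ | eq = trans eq (coeff-normalise f v)

Reduced : ∀ {n} → Poly n → Set
Reduced g = AllPairs (λ t t′ → proj₂ t ≢ proj₂ t′) g × All (λ t → proj₁ t ≢ 0ℚ) g

AllMon-insertTerm : ∀ {n} {P : Monomial n → Set} c u g → P u → AllMon P g → AllMon P (insertTerm (c , u) g)
AllMon-insertTerm c u [] pu [] with c ℚP.≟ 0ℚ
... | yes _ = []
... | no _ = pu ∷ []
AllMon-insertTerm c u ((c′ , u′) ∷ g) pu (pu′ ∷ pg) with VecP.≡-dec ℕ._≟_ u′ u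
... | yes refl with (c + c′) ℚP.≟ 0ℚ
...   | yes _ = pg
...   | no _ = pu ∷ pg
AllMon-insertTerm c u ((c′ , u′) ∷ g) pu (pu′ ∷ pg) | no _ = pu′ ∷ AllMon-insertTerm c u g pu pg

insertTerm-reduced : ∀ {n} c u (g : Poly n) → Reduced g → Reduced (insertTerm (c , u) g)
insertTerm-reduced c u [] _ with c ℚP.≟ 0ℚ
... | yes _ = [] , []
... | no c≢0 = ([] ∷ []) , (c≢0 ∷ [])
insertTerm-reduced c u ((c′ , u′) ∷ g) (u′∉g ∷ dg , c′≢0 ∷ zg) with VecP.≡-dec ℕ._≟_ u′ u
... | yes refl with (c + c′) ℚP.≟ 0ℚ
...   | yes _ = dg , zg
...   | no c+c′≢0 = (u′∉g ∷ dg) , (c+c′≢0 ∷ zg)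
insertTerm-reduced c u ((c′ , u′) ∷ g) (u′∉g ∷ dg , c′≢0 ∷ zg) | no u′≢u =
  let (dg′ , zg′) = insertTerm-reduced c u g (dg , zg) in
  (AllMon-insertTerm {P = u′ ≢_} c u g u′≢u u′∉g ∷ dg′) , (c′≢0 ∷ zg′)

normalise-reduced : ∀ {n} (f : Poly n) → Reduced (normalise f)
normalise-reduced [] = [] , []
normalise-reduced ((c , u) ∷ f) = insertTerm-reduced c u (normalise f) (normalise-reduced f)

coeff-reduced : ∀ {n} (g : Poly n) → Reduced g → ∀ {c u} → (c , u) ∈ g → coeff g u ≡ c
coeff-reduced ((c , u) ∷ g) (u∉g ∷ _ , _) (here refl) with VecP.≡-dec ℕ._≟_ u u
... | yes _ = trans (cong (c +_) (coeff-absent g u (All.map (λ u≢ → u≢ ∘ sym) u∉g))) (ℚP.+-identityʳ c)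
... | no u≢u = ⊥-elim (u≢u refl)
coeff-reduced ((c′ , u′) ∷ g) (u′∉g ∷ dg , _ ∷ zg) {c} {u} (there t∈g) with VecP.≡-dec ℕ._≟_ u′ u
... | yes refl = ⊥-elim (All.lookup u′∉g t∈g refl)
... | no _ = coeff-reduced g (dg , zg) t∈g

normalise-support : ∀ {n} (f : Poly n) → AllMon (λ u → coeff f u ≢ 0ℚ) (normalise f)
normalise-support f = All.tabulate λ {t} t∈ coeff≡0 →
  All.lookup (proj₂ red) t∈
    (trans (sym (coeff-reduced (normalise f) red t∈)) (trans (coeff-normalise f (proj₂ t)) coeff≡0))
  where red = normalise-reduced f

-- Univariate polynomials

horner : ℕ → (ℕ → ℚ) → ℚ → ℚ
horner zero a x = 0ℚ
horner (suc N) a x = a 0 + x * horner N (a ∘ suc) x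

horner-cong : ∀ N {a b : ℕ → ℚ} → (∀ t → a t ≡ b t) → ∀ x → horner N a x ≡ horner N b x
horner-cong zero a≗b x = refl
horner-cong (suc N) a≗b x = cong₂ (λ p q → p + x * q) (a≗b 0) (horner-cong N (a≗b ∘ suc) x)

horner-0 : ∀ N x → horner N (λ _ → 0ℚ) x ≡ 0ℚ
horner-0 zero x = refl
horner-0 (suc N) x =
  trans (cong (λ q → 0ℚ + x * q) (horner-0 N x)) (trans (cong (0ℚ +_) (ℚP.*-zeroʳ x)) (ℚP.+-identityˡ 0ℚ))

horner-+ : ∀ N (a b : ℕ → ℚ) x → horner N (λ t → a t + b t) x ≡ horner N a x + horner N b x
horner-+ zero a b x = sym (ℚP.+-identityˡ 0ℚ)
horner-+ (suc N) a b x =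
  trans (cong (λ q → a 0 + b 0 + x * q) (horner-+ N (a ∘ suc) (b ∘ suc) x))
    (solve 5 (λ a₀ b₀ x p q → a₀ :+ b₀ :+ x :* (p :+ q) := a₀ :+ x :* p :+ (b₀ :+ x :* q)) refl
       (a 0) (b 0) x (horner N (a ∘ suc) x) (horner N (b ∘ suc) x))

horner-monomial : ∀ d e K x → e ≤ d → horner (suc d) (λ t → if does (e ℕ.≟ t) then K else 0ℚ) x ≡ pow x e * K
horner-monomial d zero K x _ =
  trans (cong (λ q → K + x * q) (horner-0 d x))
    (trans (cong (K +_) (ℚP.*-zeroʳ x)) (trans (ℚP.+-identityʳ K) (sym (ℚP.*-identityˡ K))))
horner-monomial (suc d) (suc e) K x (s≤s e≤d) =
  trans (cong (λ q → 0ℚ + x * q) (horner-monomial d e K x e≤d))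
    (trans (ℚP.+-identityˡ _) (sym (ℚP.*-assoc x (pow x e) K)))

horner-divide : ∀ N (a : ℕ → ℚ) r → Σ (ℕ → ℚ) λ b →
  (∀ x → horner (suc (suc N)) a x ≡ (x - r) * horner (suc N) b x + horner (suc (suc N)) a r) × (b N ≡ a (suc N))
horner-divide zero a r = (λ _ → a 1) , (λ x →
  solve 4 (λ a₀ a₁ x r → a₀ :+ x :* (a₁ :+ x :* con 0ℚ)
                        := (x :- r) :* (a₁ :+ x :* con 0ℚ) :+ (a₀ :+ r :* (a₁ :+ r :* con 0ℚ))) refl
    (a 0) (a 1) x r) , refl
horner-divide (suc N) a r with horner-divide N (a ∘ suc) r
... | b′ , divides′ , lead′ = b , (λ x → trans (cong (λ q → a 0 + x * q) (divides′ x))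
        (solve 5 (λ a₀ x r B ρ → a₀ :+ x :* ((x :- r) :* B :+ ρ) := (x :- r) :* (ρ :+ x :* B) :+ (a₀ :+ r :* ρ)) refl
          (a 0) x r (horner (suc N) b′ x) ρ)) , lead′
  where
  ρ = horner (suc (suc N)) (a ∘ suc) r
  b : ℕ → ℚ
  b zero = ρ
  b (suc t) = b′ t

top-coeff-vanishes : ∀ N (a : ℕ → ℚ) (S : List ℚ) → AllPairs _≢_ S → suc N ≤ length S →
  (∀ s → s ∈ S → horner (suc N) a s ≡ 0ℚ) → a N ≡ 0ℚ
top-coeff-vanishes zero a (s ∷ S) _ _ roots =
  trans (sym (trans (cong (a 0 +_) (ℚP.*-zeroʳ s)) (ℚP.+-identityʳ (a 0)))) (roots s (here refl))
top-coeff-vanishes (suc N) a (r ∷ S) (r∉S ∷ distinct) (s≤s N<∣S∣) roots with horner-divide N a r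
... | b , divides , lead = trans (sym lead) (top-coeff-vanishes N b S distinct N<∣S∣ λ s s∈S →
       x*y≡0⇒y≡0 (s - r) (horner (suc N) b s)
         (λ s-r≡0 → All.lookup r∉S s∈S (sym (x-y≡0⇒x≡y s r s-r≡0)))
         (begin
           (s - r) * horner (suc N) b s                                ≡⟨ sym (ℚP.+-identityʳ _) ⟩
           (s - r) * horner (suc N) b s + 0ℚ
             ≡⟨ cong ((s - r) * horner (suc N) b s +_) (sym (roots r (here refl))) ⟩
           (s - r) * horner (suc N) b s + horner (suc (suc N)) a r     ≡⟨ sym (divides s) ⟩
           horner (suc (suc N)) a s                                    ≡⟨ roots s (there s∈S) ⟩
           0ℚ                                                          ∎))
  where open ≡-Reasoning

partialTerm : ∀ {n} → Fin n → ℕ → ℚ × Monomial n → Poly n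
partialTerm c t (a , u) = if does (lookup u c ℕ.≟ t) then term a (u [ c ]≔ 0) else []

partialCoeff : ∀ {n} → Fin n → ℕ → Poly n → Poly n
partialCoeff c t = concatMap (partialTerm c t)

eval-partialTerm : ∀ {n} c t b (u : Monomial n) a →
  eval (partialTerm c t (b , u)) a ≡ (if does (lookup u c ℕ.≟ t) then b * evalMon a (u [ c ]≔ 0) + 0ℚ else 0ℚ)
eval-partialTerm c t b u a with does (lookup u c ℕ.≟ t)
... | true = refl
... | false = refl

eval-as-horner : ∀ {n} c d (f : Poly n) → AllMon (λ u → lookup u c ≤ d) f → ∀ a x →
  eval f (a [ c ]≔ x) ≡ horner (suc d) (λ t → eval (partialCoeff c t f) a) x
eval-as-horner c d [] _ a x = sym (horner-0 (suc d) x)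
eval-as-horner c d ((b , u) ∷ f) (uc≤d ∷ f≤d) a x = begin
  b * evalMon (a [ c ]≔ x) u + eval f (a [ c ]≔ x)
    ≡⟨ cong₂ _+_ (cong (b *_) (evalMon-[]≔ a u c x)) (eval-as-horner c d f f≤d a x) ⟩
  b * (pow x e * M) + horner (suc d) R x
    ≡⟨ cong (_+ horner (suc d) R x) (solve 3 (λ b p m → b :* (p :* m) := p :* (b :* m :+ con 0ℚ)) refl b (pow x e) M) ⟩
  pow x e * (b * M + 0ℚ) + horner (suc d) R x
    ≡⟨ cong (_+ horner (suc d) R x) (sym (horner-monomial d e (b * M + 0ℚ) x uc≤d)) ⟩
  horner (suc d) (λ t → if does (e ℕ.≟ t) then b * M + 0ℚ else 0ℚ) x + horner (suc d) R x
    ≡⟨ sym (horner-+ (suc d) (λ t → if does (e ℕ.≟ t) then b * M + 0ℚ else 0ℚ) R x) ⟩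
  horner (suc d) (λ t → (if does (e ℕ.≟ t) then b * M + 0ℚ else 0ℚ) + R t) x
    ≡⟨ horner-cong (suc d) (λ t → sym (trans (eval-++ (partialTerm c t (b , u)) (partialCoeff c t f) a)
                                             (cong (_+ R t) (eval-partialTerm c t b u a)))) x ⟩
  horner (suc d) (λ t → eval (partialCoeff c t ((b , u) ∷ f)) a) x ∎
  where
  open ≡-Reasoning
  e = lookup u c
  M = evalMon a (u [ c ]≔ 0)
  R = λ t → eval (partialCoeff c t f) a

coeff-partialCoeff : ∀ {n} c d (f : Poly n) v → lookup v c ≡ 0 → coeff (partialCoeff c d f) v ≡ coeff f (v [ c ]≔ d)
coeff-partialCoeff c d [] v _ = refl
coeff-partialCoeff c d ((b , u) ∷ f) v vc≡0 =
  trans (coeff-++ (partialTerm c d (b , u)) (partialCoeff c d f) v) (split (lookup u c ℕ.≟ d))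
  where
  ih = coeff-partialCoeff c d f v vc≡0
  split : (uc≟d : Dec (lookup u c ≡ d)) →
    coeff (if does uc≟d then term b (u [ c ]≔ 0) else []) v + coeff (partialCoeff c d f) v ≡ coeff ((b , u) ∷ f) (v [ c ]≔ d)
  split (yes uc≡d) with VecP.≡-dec ℕ._≟_ (u [ c ]≔ 0) v | VecP.≡-dec ℕ._≟_ u (v [ c ]≔ d)
  ... | yes _ | yes _ = cong₂ _+_ (ℚP.+-identityʳ b) ih
  ... | yes u₀≡v | no u≢v₁ = ⊥-elim (u≢v₁ (begin
        u                        ≡⟨ sym (VecP.[]≔-lookup u c) ⟩
        u [ c ]≔ lookup u c      ≡⟨ cong (u [ c ]≔_) uc≡d ⟩
        u [ c ]≔ d               ≡⟨ sym (VecP.[]≔-idempotent u c) ⟩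
        u [ c ]≔ 0 [ c ]≔ d      ≡⟨ cong (_[ c ]≔ d) u₀≡v ⟩
        v [ c ]≔ d               ∎))
    where open ≡-Reasoning
  ... | no u₀≢v | yes u≡v₁ = ⊥-elim (u₀≢v (begin
        u [ c ]≔ 0               ≡⟨ cong (_[ c ]≔ 0) u≡v₁ ⟩
        v [ c ]≔ d [ c ]≔ 0      ≡⟨ VecP.[]≔-idempotent v c ⟩
        v [ c ]≔ 0               ≡⟨ cong (v [ c ]≔_) (sym vc≡0) ⟩
        v [ c ]≔ lookup v c      ≡⟨ VecP.[]≔-lookup v c ⟩
        v                        ∎))
    where open ≡-Reasoning
  ... | no _ | no _ = trans (ℚP.+-identityˡ _) ih
  split (no uc≢d) with VecP.≡-dec ℕ._≟_ u (v [ c ]≔ d)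
  ... | yes u≡v₁ = ⊥-elim (uc≢d (trans (cong (λ z → lookup z c) u≡v₁) (VecP.lookup∘update c v d)))
  ... | no _ = trans (ℚP.+-identityˡ _) ih

AllMon-partialCoeff : ∀ {n} {P Q : Monomial n → Set} c d (f : Poly n) → AllMon P f →
  (∀ u → P u → lookup u c ≡ d → Q (u [ c ]≔ 0)) → AllMon Q (partialCoeff c d f)
AllMon-partialCoeff c d [] [] _ = []
AllMon-partialCoeff {Q = Q} c d ((b , u) ∷ f) (pu ∷ pf) P⇒Q =
  AllMon-++ (split (lookup u c ℕ.≟ d)) (AllMon-partialCoeff c d f pf P⇒Q)
  where
  split : (uc≟d : Dec (lookup u c ≡ d)) → AllMon Q (if does uc≟d then term b (u [ c ]≔ 0) else [])
  split (yes uc≡d) = P⇒Q u pu uc≡d ∷ []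
  split (no _) = []

-- Interpolation

Pure : ∀ {n} → Fin n → Monomial n → Set
Pure j u = ∀ i → i ≢ j → lookup u i ≡ 0

pure-𝟙 : ∀ {n} (j : Fin n) → Pure j 𝟙
pure-𝟙 j i _ = VecP.lookup-replicate i 0

pure-x^ : ∀ {n} (j : Fin n) t → Pure j (x^ j t)
pure-x^ j t i i≢j = trans (VecP.lookup∘update′ i≢j 𝟙 t) (pure-𝟙 j i i≢j)

pure-⊕ : ∀ {n} (j : Fin n) u v → Pure j u → Pure j v → Pure j (u ⊕ v)
pure-⊕ j u v pu pv i i≢j = trans (lookup-⊕ u v i) (cong₂ ℕ._+_ (pu i i≢j) (pv i i≢j))

lagrangeFactor : ∀ {n} → Fin n → ℕ → ℕ → Poly n
lagrangeFactor j β γ = (ι , x^ j 1) ∷ term (- (toℚ γ * ι)) 𝟙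
  where ι = inv₀ (toℚ β - toℚ γ)

eval-lagrangeFactor : ∀ {n} (j : Fin n) β γ a →
  eval (lagrangeFactor j β γ) a ≡ inv₀ (toℚ β - toℚ γ) * (lookup a j - toℚ γ)
eval-lagrangeFactor j β γ a =
  trans (cong₂ (λ p q → ι * p + (- (toℚ γ * ι) * q + 0ℚ)) (evalMon-x^ a j 1) (evalMon-𝟙 a))
    (solve 3 (λ ι x γ → ι :* (x :* con 1ℚ) :+ (:- (γ :* ι) :* con 1ℚ :+ con 0ℚ) := ι :* (x :- γ)) refl
       ι (lookup a j) (toℚ γ))
  where ι = inv₀ (toℚ β - toℚ γ)

lagrangeBasis : ∀ {n} → Fin n → ℕ → List ℕ → Poly n
lagrangeBasis j β [] = term 1ℚ 𝟙
lagrangeBasis j β (γ ∷ γs) with γ ℕ.≟ β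
... | yes _ = lagrangeBasis j β γs
... | no _ = lagrangeFactor j β γ *ₚ lagrangeBasis j β γs

lagrangeBasis-pure : ∀ {n} (j : Fin n) β γs → AllMon (Pure j) (lagrangeBasis j β γs)
lagrangeBasis-pure j β [] = pure-𝟙 j ∷ []
lagrangeBasis-pure j β (γ ∷ γs) with γ ℕ.≟ β
... | yes _ = lagrangeBasis-pure j β γs
... | no _ = AllMon-*ₚ (pure-⊕ j) {f = lagrangeFactor j β γ} (pure-x^ j 1 ∷ pure-𝟙 j ∷ []) (lagrangeBasis-pure j β γs)

lagrangeBasis-node : ∀ {n} (j : Fin n) β γs a → lookup a j ≡ toℚ β → eval (lagrangeBasis j β γs) a ≡ 1ℚ
lagrangeBasis-node j β [] a _ = trans (eval-term 1ℚ 𝟙 a) (trans (ℚP.*-identityˡ _) (evalMon-𝟙 a))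
lagrangeBasis-node j β (γ ∷ γs) a aj≡β with γ ℕ.≟ β
... | yes _ = lagrangeBasis-node j β γs a aj≡β
... | no γ≢β = begin
  eval (lagrangeFactor j β γ *ₚ lagrangeBasis j β γs) a
    ≡⟨ eval-*ₚ (lagrangeFactor j β γ) (lagrangeBasis j β γs) a ⟩
  eval (lagrangeFactor j β γ) a * eval (lagrangeBasis j β γs) a
    ≡⟨ cong₂ _*_ (eval-lagrangeFactor j β γ a) (lagrangeBasis-node j β γs a aj≡β) ⟩
  inv₀ (toℚ β - toℚ γ) * (lookup a j - toℚ γ) * 1ℚ
    ≡⟨ cong (λ z → inv₀ (toℚ β - toℚ γ) * (z - toℚ γ) * 1ℚ) aj≡β ⟩
  inv₀ (toℚ β - toℚ γ) * (toℚ β - toℚ γ) * 1ℚ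
    ≡⟨ cong (_* 1ℚ) (trans (ℚP.*-comm (inv₀ (toℚ β - toℚ γ)) (toℚ β - toℚ γ)) (*-inv₀ (toℚ β - toℚ γ) β-γ≢0)) ⟩
  1ℚ * 1ℚ
    ≡⟨ ℚP.*-identityˡ 1ℚ ⟩
  1ℚ ∎
  where
  open ≡-Reasoning
  β-γ≢0 : toℚ β - toℚ γ ≢ 0ℚ
  β-γ≢0 β-γ≡0 = γ≢β (sym (toℚ-injective (x-y≡0⇒x≡y (toℚ β) (toℚ γ) β-γ≡0)))

lagrangeBasis-other-node : ∀ {n} (j : Fin n) β γs a p → lookup a j ≡ toℚ p → p ≢ β → p ∈ γs →
  eval (lagrangeBasis j β γs) a ≡ 0ℚ
lagrangeBasis-other-node j β (γ ∷ γs) a p aj≡p p≢β p∈ with γ ℕ.≟ β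
lagrangeBasis-other-node j β (γ ∷ γs) a p aj≡p p≢β (here refl) | yes γ≡β = ⊥-elim (p≢β γ≡β)
lagrangeBasis-other-node j β (γ ∷ γs) a p aj≡p p≢β (there p∈) | yes _ =
  lagrangeBasis-other-node j β γs a p aj≡p p≢β p∈
... | no _ = trans (eval-*ₚ (lagrangeFactor j β γ) (lagrangeBasis j β γs) a) (factorOrRest p∈)
  where
  factorOrRest : p ∈ γ ∷ γs → eval (lagrangeFactor j β γ) a * eval (lagrangeBasis j β γs) a ≡ 0ℚ
  factorOrRest (here refl) = begin
    eval (lagrangeFactor j β γ) a * eval (lagrangeBasis j β γs) a
      ≡⟨ cong (_* eval (lagrangeBasis j β γs) a) (eval-lagrangeFactor j β γ a) ⟩
    inv₀ (toℚ β - toℚ γ) * (lookup a j - toℚ γ) * eval (lagrangeBasis j β γs) a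
      ≡⟨ cong (λ z → inv₀ (toℚ β - toℚ γ) * z * eval (lagrangeBasis j β γs) a)
              (trans (cong (_- toℚ γ) aj≡p) (ℚP.+-inverseʳ (toℚ γ))) ⟩
    inv₀ (toℚ β - toℚ γ) * 0ℚ * eval (lagrangeBasis j β γs) a
      ≡⟨ cong (_* eval (lagrangeBasis j β γs) a) (ℚP.*-zeroʳ (inv₀ (toℚ β - toℚ γ))) ⟩
    0ℚ * eval (lagrangeBasis j β γs) a
      ≡⟨ ℚP.*-zeroˡ (eval (lagrangeBasis j β γs) a) ⟩
    0ℚ ∎
    where open ≡-Reasoning
  factorOrRest (there p∈γs) =
    trans (cong (eval (lagrangeFactor j β γ) a *_) (lagrangeBasis-other-node j β γs a p aj≡p p≢β p∈γs))
      (ℚP.*-zeroʳ (eval (lagrangeFactor j β γ) a))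

DependsOnlyOn : ∀ {n} {A : Set} → List (Fin n) → (Vec ℕ n → A) → Set
DependsOnlyOn T r = ∀ p q → (∀ i → i ∈ T → lookup p i ≡ lookup q i) → r p ≡ r q

module Interpolation (K : ℕ) where

  basis : ∀ {n} → Fin n → ℕ → Poly n
  basis j β = lagrangeBasis j β (downFrom K)

  lagrangeSum : ∀ {n} → Fin n → (ℕ → Poly n) → ℕ → Poly n
  lagrangeSum j Y m = concatMap (λ β → basis j β *ₚ Y β) (downFrom m)

  module _ {n} (j : Fin n) (Y : ℕ → Poly n) (a : Vec ℚ n) {p} (aj≡p : lookup a j ≡ toℚ p) (p<K : p < K) where

    eval-basis-off-node : ∀ β → p ≢ β → eval (basis j β *ₚ Y β) a ≡ 0ℚ
    eval-basis-off-node β p≢β =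
      trans (eval-*ₚ (basis j β) (Y β) a)
        (trans (cong (_* eval (Y β) a) (lagrangeBasis-other-node j β (downFrom K) a p aj≡p p≢β (∈P.∈-downFrom⁺ p<K)))
          (ℚP.*-zeroˡ (eval (Y β) a)))

    eval-lagrangeSum-≤ : ∀ m → m ≤ p → eval (lagrangeSum j Y m) a ≡ 0ℚ
    eval-lagrangeSum-≤ zero _ = refl
    eval-lagrangeSum-≤ (suc m) m<p =
      trans (eval-++ (basis j m *ₚ Y m) (lagrangeSum j Y m) a)
        (trans (cong₂ _+_ (eval-basis-off-node m (ℕP.>⇒≢ m<p)) (eval-lagrangeSum-≤ m (ℕP.<⇒≤ m<p)))
          (ℚP.+-identityʳ 0ℚ))

    eval-lagrangeSum : ∀ m → p < m → eval (lagrangeSum j Y m) a ≡ eval (Y p) a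
    eval-lagrangeSum (suc m) (s≤s p≤m) with p ℕ.≟ m
    ... | yes refl =
      trans (eval-++ (basis j p *ₚ Y p) (lagrangeSum j Y p) a)
        (trans (cong₂ _+_ (trans (eval-*ₚ (basis j p) (Y p) a)
                            (trans (cong (_* eval (Y p) a) (lagrangeBasis-node j p (downFrom K) a aj≡p))
                                   (ℚP.*-identityˡ (eval (Y p) a))))
                          (eval-lagrangeSum-≤ p ℕP.≤-refl))
          (ℚP.+-identityʳ (eval (Y p) a)))
    ... | no p≢m =
      trans (eval-++ (basis j m *ₚ Y m) (lagrangeSum j Y m) a)
        (trans (cong₂ _+_ (eval-basis-off-node m p≢m) (eval-lagrangeSum m (ℕP.≤∧≢⇒< p≤m p≢m)))
          (ℚP.+-identityˡ (eval (Y p) a)))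

  interpolate : ∀ {n} → List (Fin n) → (Vec ℕ n → Poly n) → Poly n
  interpolate [] r = r 𝟙
  interpolate (j ∷ T) r = lagrangeSum j (λ β → interpolate T (λ q → r (q [ j ]≔ β))) K

  eval-interpolate : ∀ {n} (T : List (Fin n)) (r : Vec ℕ n → Poly n) → DependsOnlyOn T r →
    ∀ p → (∀ i → i ∈ T → lookup p i < K) → eval (interpolate T r) (toℚⁿ p) ≡ eval (r p) (toℚⁿ p)
  eval-interpolate [] r r-local p _ = cong (λ z → eval z (toℚⁿ p)) (r-local 𝟙 p (λ i ()))
  eval-interpolate (j ∷ T) r r-local p p∈grid = begin
    eval (lagrangeSum j (λ β → interpolate T (λ q → r (q [ j ]≔ β))) K) (toℚⁿ p)
      ≡⟨ eval-lagrangeSum j _ (toℚⁿ p) (VecP.lookup-map j toℚ p) (p∈grid j (here refl)) K (p∈grid j (here refl)) ⟩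
    eval (interpolate T (λ q → r (q [ j ]≔ lookup p j))) (toℚⁿ p)
      ≡⟨ eval-interpolate T (λ q → r (q [ j ]≔ lookup p j)) r′-local p (λ i i∈T → p∈grid i (there i∈T)) ⟩
    eval (r (p [ j ]≔ lookup p j)) (toℚⁿ p)
      ≡⟨ cong (λ z → eval (r z) (toℚⁿ p)) (VecP.[]≔-lookup p j) ⟩
    eval (r p) (toℚⁿ p) ∎
    where
    open ≡-Reasoning
    r′-local : DependsOnlyOn T (λ q → r (q [ j ]≔ lookup p j))
    r′-local q q′ q≈q′ = r-local _ _ λ i i∈ →
      trans (lookup-[]≔ q j _ i) (trans (agree i i∈) (sym (lookup-[]≔ q′ j _ i)))
      where
      agree : ∀ i → i ∈ j ∷ T →
        (if does (i Fin.≟ j) then lookup p j else lookup q i) ≡ (if does (i Fin.≟ j) then lookup p j else lookup q′ i)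
      agree i i∈ with i Fin.≟ j
      ... | yes _ = refl
      agree i (here i≡j) | no i≢j = ⊥-elim (i≢j i≡j)
      agree i (there i∈T) | no _ = q≈q′ i i∈T

  AllMon-interpolate : ∀ {n} {P : Monomial n → Set} (T : List (Fin n)) (r : Vec ℕ n → Poly n) →
    (∀ p → AllMon P (r p)) → (∀ j → j ∈ T → ∀ u v → Pure j u → P v → P (u ⊕ v)) → AllMon P (interpolate T r)
  AllMon-interpolate [] r Pr _ = Pr 𝟙
  AllMon-interpolate (j ∷ T) r Pr closed = AllMon-concatMap _ (downFrom K) λ β →
    AllMon-*ₚ (closed j (here refl)) {f = basis j β} (lagrangeBasis-pure j β (downFrom K))
      (AllMon-interpolate T (λ p → r (p [ j ]≔ β)) (λ p → Pr _) (λ j′ j′∈T → closed j′ (there j′∈T)))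

rootProduct : List ℕ → ℚ → ℚ
rootProduct [] x = 1ℚ
rootProduct (α ∷ F) x = (x - toℚ α) * rootProduct F x

rootProduct-root : ∀ F p → p ∈ F → rootProduct F (toℚ p) ≡ 0ℚ
rootProduct-root (α ∷ F) p (here refl) =
  trans (cong (_* rootProduct F (toℚ α)) (ℚP.+-inverseʳ (toℚ α))) (ℚP.*-zeroˡ (rootProduct F (toℚ α)))
rootProduct-root (α ∷ F) p (there p∈F) =
  trans (cong ((toℚ p - toℚ α) *_) (rootProduct-root F p p∈F)) (ℚP.*-zeroʳ (toℚ p - toℚ α))

-- ∏_{α ∈ F} (x_c − α) − x_c^{|F|}, built so that no monomial of x_c-degree |F| ever occurs.
rootProductTail : ∀ {n} → Fin n → List ℕ → Poly n
rootProductTail c [] = []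
rootProductTail c (α ∷ F) =
  term 1ℚ (x^ c 1) *ₚ L ++ (- toℚ α , x^ c (length F)) ∷ term (- toℚ α) 𝟙 *ₚ L
  where L = rootProductTail c F

eval-rootProductTail : ∀ {n} (c : Fin n) F a →
  eval (rootProductTail c F) a ≡ rootProduct F (lookup a c) - pow (lookup a c) (length F)
eval-rootProductTail c [] a = sym (ℚP.+-inverseʳ 1ℚ)
eval-rootProductTail c (α ∷ F) a = begin
  eval (term 1ℚ (x^ c 1) *ₚ L ++ (- toℚ α , x^ c (length F)) ∷ term (- toℚ α) 𝟙 *ₚ L) a
    ≡⟨ eval-++ (term 1ℚ (x^ c 1) *ₚ L) _ a ⟩
  eval (term 1ℚ (x^ c 1) *ₚ L) a + (- toℚ α * evalMon a (x^ c (length F)) + eval (term (- toℚ α) 𝟙 *ₚ L) a)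
    ≡⟨ cong₂ (λ p q → p + (- toℚ α * evalMon a (x^ c (length F)) + q))
             (eval-*ₚ (term 1ℚ (x^ c 1)) L a) (eval-*ₚ (term (- toℚ α) 𝟙) L a) ⟩
  (1ℚ * evalMon a (x^ c 1) + 0ℚ) * eval L a + (- toℚ α * evalMon a (x^ c (length F)) + (- toℚ α * evalMon a 𝟙 + 0ℚ) * eval L a)
    ≡⟨ cong₂ (λ p q → (1ℚ * p + 0ℚ) * eval L a + q) (evalMon-x^ a c 1)
             (cong₂ (λ p q → - toℚ α * p + (- toℚ α * q + 0ℚ) * eval L a) (evalMon-x^ a c (length F)) (evalMon-𝟙 a)) ⟩
  (1ℚ * (x * 1ℚ) + 0ℚ) * eval L a + (- toℚ α * X + (- toℚ α * 1ℚ + 0ℚ) * eval L a)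
    ≡⟨ cong (λ l → (1ℚ * (x * 1ℚ) + 0ℚ) * l + (- toℚ α * X + (- toℚ α * 1ℚ + 0ℚ) * l)) (eval-rootProductTail c F a) ⟩
  (1ℚ * (x * 1ℚ) + 0ℚ) * (P - X) + (- toℚ α * X + (- toℚ α * 1ℚ + 0ℚ) * (P - X))
    ≡⟨ solve 4 (λ x α P X → (con 1ℚ :* (x :* con 1ℚ) :+ con 0ℚ) :* (P :- X)
                            :+ (:- α :* X :+ (:- α :* con 1ℚ :+ con 0ℚ) :* (P :- X))
                := (x :- α) :* P :- x :* X) refl x (toℚ α) P X ⟩
  (x - toℚ α) * P - x * X ∎
  where
  open ≡-Reasoning
  L = rootProductTail c F
  x = lookup a c
  X = pow x (length F)
  P = rootProduct F x

PureBelow : ∀ {n} → Fin n → ℕ → Monomial n → Set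
PureBelow c b u = Pure c u × lookup u c < b

x^-⊕-pureBelow : ∀ {n} (c : Fin n) s b v → PureBelow c b v → PureBelow c (s ℕ.+ b) (x^ c s ⊕ v)
x^-⊕-pureBelow c s b v (pv , vc<b) =
  pure-⊕ c (x^ c s) v (pure-x^ c s) pv ,
  subst (_< s ℕ.+ b) (sym (trans (lookup-⊕ (x^ c s) v c) (cong (ℕ._+ lookup v c) (lookup-x^ c s))))
    (ℕP.+-monoʳ-< s vc<b)

rootProductTail-pureBelow : ∀ {n} (c : Fin n) F → AllMon (PureBelow c (length F)) (rootProductTail c F)
rootProductTail-pureBelow c [] = []
rootProductTail-pureBelow c (α ∷ F) = AllMon-++
  (AllMon-term-*ₚ 1ℚ (x^ c 1) (x^-⊕-pureBelow c 1 (length F)) (rootProductTail-pureBelow c F))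
  ((pure-x^ c (length F) , subst (_< suc (length F)) (sym (lookup-x^ c (length F))) ℕP.≤-refl) ∷
   AllMon-term-*ₚ (- toℚ α) 𝟙 (λ v below → subst (PureBelow c (suc (length F))) (sym (𝟙-⊕ v)) (weaken {v} below))
     (rootProductTail-pureBelow c F))
  where
  weaken : ∀ {u} → PureBelow c (length F) u → PureBelow c (suc (length F)) u
  weaken (pu , uc<) = pu , ℕP.m<n⇒m<1+n uc<

rootCorrection : ∀ {n} → Fin n → ℕ → List ℕ → Poly n
rootCorrection c d F with length F ℕ.≤? d
... | yes _ = term 1ℚ (x^ c (d ℕ.∸ length F)) *ₚ rootProductTail c F
... | no _ = []

rootCorrection-pureBelow : ∀ {n} (c : Fin n) d F → AllMon (PureBelow c d) (rootCorrection c d F)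
rootCorrection-pureBelow c d F with length F ℕ.≤? d
... | no _ = []
... | yes ∣F∣≤d = AllMon-term-*ₚ 1ℚ (x^ c (d ℕ.∸ length F))
  (λ v below → subst (λ b → PureBelow c b (x^ c (d ℕ.∸ length F) ⊕ v)) (ℕP.m∸n+n≡m ∣F∣≤d)
                       (x^-⊕-pureBelow c (d ℕ.∸ length F) (length F) v below))
  (rootProductTail-pureBelow c F)

rootCorrection-cancels : ∀ {n} (c : Fin n) d F a p → length F ≤ d → p ∈ F → lookup a c ≡ toℚ p →
  eval (rootCorrection c d F) a + pow (lookup a c) d ≡ 0ℚ
rootCorrection-cancels c d F a p ∣F∣≤d p∈F ac≡p with length F ℕ.≤? d
... | no ∣F∣≰d = ⊥-elim (∣F∣≰d ∣F∣≤d)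
... | yes _ = begin
  eval (term 1ℚ (x^ c s) *ₚ rootProductTail c F) a + pow x d
    ≡⟨ cong₂ _+_ (eval-*ₚ (term 1ℚ (x^ c s)) (rootProductTail c F) a)
                 (trans (cong (pow x) (sym (ℕP.m∸n+n≡m ∣F∣≤d))) (pow-+ x s (length F))) ⟩
  (1ℚ * evalMon a (x^ c s) + 0ℚ) * eval (rootProductTail c F) a + pow x s * pow x (length F)
    ≡⟨ cong₂ (λ p q → (1ℚ * p + 0ℚ) * q + pow x s * pow x (length F)) (evalMon-x^ a c s)
             (trans (eval-rootProductTail c F a) (cong (λ z → rootProduct F z - pow x (length F)) ac≡p)) ⟩
  (1ℚ * pow x s + 0ℚ) * (rootProduct F (toℚ p) - pow x (length F)) + pow x s * pow x (length F)
    ≡⟨ cong (λ z → (1ℚ * pow x s + 0ℚ) * (z - pow x (length F)) + pow x s * pow x (length F)) (rootProduct-root F p p∈F) ⟩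
  (1ℚ * pow x s + 0ℚ) * (0ℚ - pow x (length F)) + pow x s * pow x (length F)
    ≡⟨ solve 2 (λ A B → (con 1ℚ :* A :+ con 0ℚ) :* (con 0ℚ :- B) :+ A :* B := con 0ℚ) refl (pow x s) (pow x (length F)) ⟩
  0ℚ ∎
  where
  open ≡-Reasoning
  x = lookup a c
  s = d ℕ.∸ length F

-- The variable order

<-suc-≢ : ∀ {a m} → a < suc m → a ≢ m → a < m
<-suc-≢ (s≤s a≤m) a≢m = ℕP.≤∧≢⇒< a≤m a≢m

module Ordering {n′} (σ : Permutation′ (suc n′)) where

  n : ℕ
  n = suc n′

  -- the rank of x_i in the variable order: x_{at 0} ≻ x_{at 1} ≻ ⋯
  pos : Fin n → ℕ
  pos i = toℕ (σ ⟨$⟩ˡ i)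

  pos-injective : ∀ {i j} → pos i ≡ pos j → i ≡ j
  pos-injective eq = trans (sym (inverseʳ σ)) (trans (cong (σ ⟨$⟩ʳ_) (FinP.toℕ-injective eq)) (inverseʳ σ))

  pos<n : ∀ i → pos i < n
  pos<n i = FinP.toℕ<n (σ ⟨$⟩ˡ i)

  -- the variable of rank m, for m < n (and junk beyond)
  at : ℕ → Fin n
  at m with m ℕ.<? n
  ... | yes m<n = σ ⟨$⟩ʳ fromℕ< m<n
  ... | no _ = σ ⟨$⟩ʳ Fin.zero

  pos-at : ∀ {m} → m < n → pos (at m) ≡ m
  pos-at {m} m<n with m ℕ.<? n
  ... | yes m<n′ = trans (cong toℕ (inverseˡ σ)) (FinP.toℕ-fromℕ< m<n′)
  ... | no m≮n = ⊥-elim (m≮n m<n)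

  at-toℕ : ∀ j → at (toℕ j) ≡ σ ⟨$⟩ʳ j
  at-toℕ j = pos-injective (trans (pos-at (FinP.toℕ<n j)) (sym (cong toℕ (inverseˡ σ))))

  at<1+ : ∀ {m} → m < n → pos (at m) < suc m
  at<1+ {m} m<n = subst (_< suc m) (sym (pos-at m<n)) ℕP.≤-refl

  at≮ : ∀ {m} → m < n → ¬ pos (at m) < m
  at≮ m<n = ℕP.<-irrefl (pos-at m<n)

  reversedOrder≡ : reversedOrder σ ≡ applyDownFrom at n
  reversedOrder≡ = begin
    reverse (List.map (σ ⟨$⟩ʳ_) (allFin n))   ≡⟨ cong reverse (ListP.map-tabulate (λ i → i) (σ ⟨$⟩ʳ_)) ⟩
    reverse (List.tabulate (σ ⟨$⟩ʳ_))          ≡⟨ cong reverse (tabulate≡applyUpTo {g = at} (λ j → sym (at-toℕ j))) ⟩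
    reverse (applyUpTo at n)                   ≡⟨ ListP.reverse-applyUpTo at n ⟩
    applyDownFrom at n                         ∎
    where
    open ≡-Reasoning
    tabulate≡applyUpTo : ∀ {A : Set} {N} {f : Fin N → A} {g : ℕ → A} → (∀ i → f i ≡ g (toℕ i)) →
      List.tabulate f ≡ applyUpTo g N
    tabulate≡applyUpTo {N = zero} f≗g = refl
    tabulate≡applyUpTo {N = suc N} f≗g = cong₂ _∷_ (f≗g Fin.zero) (tabulate≡applyUpTo (f≗g ∘ Fin.suc))

  infix 4 _≺_ _⪯_

  -- LexLt σ, with the first differing variable named directly rather than by its rank
  _≺_ : Monomial n → Monomial n → Set
  u ≺ v = Σ (Fin n) λ i → (∀ i′ → pos i′ < pos i → lookup u i′ ≡ lookup v i′) × lookup u i < lookup v i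

  _⪯_ : Monomial n → Monomial n → Set
  u ⪯ v = u ≡ v ⊎ u ≺ v

  LexLt⇒≺ : ∀ {u v} → LexLt σ u v → u ≺ v
  LexLt⇒≺ {u} {v} (j , prefix , lt) = σ ⟨$⟩ʳ j ,
    (λ i′ i′<j → subst (λ z → lookup u z ≡ lookup v z) (inverseʳ σ)
                   (prefix (σ ⟨$⟩ˡ i′) (subst (pos i′ <_) (cong toℕ (inverseˡ σ)) i′<j))) ,
    lt

  ≺⇒LexLt : ∀ {u v} → u ≺ v → LexLt σ u v
  ≺⇒LexLt {u} {v} (i , prefix , lt) = σ ⟨$⟩ˡ i ,
    (λ j′ j′<i → prefix (σ ⟨$⟩ʳ j′) (subst (_< pos i) (sym (cong toℕ (inverseˡ σ))) j′<i)) ,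
    subst (λ z → lookup u z < lookup v z) (sym (inverseʳ σ)) lt

  ≺-irrefl : ∀ {u} → ¬ (u ≺ u)
  ≺-irrefl (i , _ , lt) = ℕP.<-irrefl refl lt

  ≺-asym : ∀ {u v} → u ≺ v → ¬ (v ≺ u)
  ≺-asym (i₁ , prefix₁ , lt₁) (i₂ , prefix₂ , lt₂) with ℕ.<-cmp (pos i₁) (pos i₂)
  ... | tri< p₁<p₂ _ _ = ℕP.<-irrefl (sym (prefix₂ i₁ p₁<p₂)) lt₁
  ... | tri> _ _ p₂<p₁ = ℕP.<-irrefl (sym (prefix₁ i₂ p₂<p₁)) lt₂
  ... | tri≈ _ p₁≡p₂ _ with pos-injective p₁≡p₂
  ...   | refl = ℕP.<-asym lt₁ lt₂

  ⪯-≺-asym : ∀ {u v} → u ⪯ v → ¬ (v ≺ u)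
  ⪯-≺-asym {u} (inj₁ refl) = ≺-irrefl {u}
  ⪯-≺-asym {u} {v} (inj₂ u≺v) = ≺-asym {u} {v} u≺v

  ≺-[]≔ : ∀ {u v} c x → u ≺ v → lookup u c ≡ lookup v c → u [ c ]≔ x ≺ v [ c ]≔ x
  ≺-[]≔ {u} {v} c x (i , prefix , lt) uc≡vc with i Fin.≟ c
  ... | yes refl = ⊥-elim (ℕP.<-irrefl uc≡vc lt)
  ... | no i≢c = i ,
    (λ i′ i′<i → trans (lookup-[]≔ u c x i′) (trans (agree i′ i′<i) (sym (lookup-[]≔ v c x i′)))) ,
    subst₂ _<_ (sym (VecP.lookup∘update′ i≢c u x)) (sym (VecP.lookup∘update′ i≢c v x)) lt
    where
    agree : ∀ i′ → pos i′ < pos i →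
      (if does (i′ Fin.≟ c) then x else lookup u i′) ≡ (if does (i′ Fin.≟ c) then x else lookup v i′)
    agree i′ i′<i with i′ Fin.≟ c
    ... | yes _ = refl
    ... | no _ = prefix i′ i′<i

  compare-prefix : ∀ u v m → (∀ i → pos i < m → lookup u i ≡ lookup v i) ⊎ u ≺ v ⊎ v ≺ u
  compare-prefix u v zero = inj₁ (λ i ())
  compare-prefix u v (suc m) with compare-prefix u v m
  ... | inj₂ decided = inj₂ decided
  ... | inj₁ agree with m ℕ.<? n
  ...   | no m≮n = inj₁ (λ i _ → agree i (ℕP.<-≤-trans (pos<n i) (ℕP.≮⇒≥ m≮n)))
  ...   | yes m<n with ℕ.<-cmp (lookup u (at m)) (lookup v (at m))
  ...     | tri< lt _ _ = inj₂ (inj₁ (at m , (λ i i<c → agree i (subst (pos i <_) (pos-at m<n) i<c)) , lt))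
  ...     | tri> _ _ gt = inj₂ (inj₂ (at m , (λ i i<c → sym (agree i (subst (pos i <_) (pos-at m<n) i<c))) , gt))
  ...     | tri≈ _ eq _ = inj₁ agree′
    where
    agree′ : ∀ i → pos i < suc m → lookup u i ≡ lookup v i
    agree′ i i<m+1 with pos i ℕ.≟ m
    ... | yes i≡m with pos-injective (trans i≡m (sym (pos-at m<n)))
    ...   | refl = eq
    agree′ i i<m+1 | no i≢m = agree i (<-suc-≢ i<m+1 i≢m)

  ≺-trichotomy : ∀ u v → u ≺ v ⊎ u ≡ v ⊎ v ≺ u
  ≺-trichotomy u v with compare-prefix u v n
  ... | inj₁ agree = inj₂ (inj₁ (lookup-ext λ i → agree i (pos<n i)))
  ... | inj₂ (inj₁ u≺v) = inj₁ u≺v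
  ... | inj₂ (inj₂ v≺u) = inj₂ (inj₂ v≺u)

  coeff-above-max : ∀ (f : Poly n) W → AllMon (_⪯ W) f → ∀ u → W ≺ u → coeff f u ≡ 0ℚ
  coeff-above-max f W f⪯W u W≺u = coeff-absent f u (All.map (λ t⪯W t≡u → ⪯-≺-asym (subst (_⪯ W) t≡u t⪯W) W≺u) f⪯W)

  pick : ℕ → Vec ℕ n → Vec ℕ n → Fin n → ℕ
  pick m p q i = if does (pos i ℕ.<? m) then lookup p i else lookup q i

  splice : ℕ → Vec ℕ n → Vec ℕ n → Vec ℕ n
  splice m p q = tabulate (pick m p q)

  lookup-splice-< : ∀ {m} p q {i} → pos i < m → lookup (splice m p q) i ≡ lookup p i
  lookup-splice-< {m} p q {i} i<m =
    trans (VecP.lookup∘tabulate (pick m p q) i)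
      (cong (if_then lookup p i else lookup q i) (dec-true (pos i ℕ.<? m) i<m))

  lookup-splice-≮ : ∀ {m} p q {i} → ¬ pos i < m → lookup (splice m p q) i ≡ lookup q i
  lookup-splice-≮ {m} p q {i} i≮m =
    trans (VecP.lookup∘tabulate (pick m p q) i)
      (cong (if_then lookup p i else lookup q i) (dec-false (pos i ℕ.<? m) i≮m))

  splice-≡ : ∀ {m} p q → (∀ i → pos i < m → lookup p i ≡ lookup q i) → splice m p q ≡ q
  splice-≡ {m} p q p≈q = lookup-ext λ i → case {i} (pos i ℕ.<? m)
    where
    case : ∀ {i} → Dec (pos i < m) → lookup (splice m p q) i ≡ lookup q i
    case {i} (yes i<m) = trans (lookup-splice-< p q i<m) (p≈q i i<m)
    case (no i≮m) = lookup-splice-≮ p q i≮m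

  splice-0 : ∀ p q → splice 0 p q ≡ q
  splice-0 p q = splice-≡ {0} p q (λ i ())

  splice-n : ∀ p q → splice n p q ≡ p
  splice-n p q = lookup-ext λ i → lookup-splice-< p q (pos<n i)

  splice-suc : ∀ {m} → m < n → ∀ p q → splice (suc m) p q ≡ splice m p q [ at m ]≔ lookup p (at m)
  splice-suc {m} m<n p q = lookup-ext λ i → trans (entry i) (sym (lookup-[]≔ (splice m p q) (at m) _ i))
    where
    entry : ∀ i → lookup (splice (suc m) p q) i ≡
      (if does (i Fin.≟ at m) then lookup p (at m) else lookup (splice m p q) i)
    entry i with i Fin.≟ at m
    ... | yes refl = lookup-splice-< p q (subst (_< suc m) (sym (pos-at m<n)) ℕP.≤-refl)
    ... | no i≢c with pos i ℕ.<? m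
    ...   | yes i<m = trans (lookup-splice-< p q (ℕP.m<n⇒m<1+n i<m)) (sym (lookup-splice-< p q i<m))
    ...   | no i≮m = trans (lookup-splice-≮ p q (λ i<m+1 → i≮m (<-suc-≢ i<m+1 (i≢c ∘ pos-injective ∘ at-rank))))
                           (sym (lookup-splice-≮ p q i≮m))
      where
      at-rank : pos i ≡ m → pos i ≡ pos (at m)
      at-rank i≡m = trans i≡m (sym (pos-at m<n))

  splice-[]≔ : ∀ {m} p q c α → ¬ pos c < m → splice m p (q [ c ]≔ α) ≡ splice m p q [ c ]≔ α
  splice-[]≔ {m} p q c α c≮m = lookup-ext λ i → trans (entry i) (sym (lookup-[]≔ (splice m p q) c α i))
    where
    entry : ∀ i → lookup (splice m p (q [ c ]≔ α)) i ≡ (if does (i Fin.≟ c) then α else lookup (splice m p q) i)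
    entry i with i Fin.≟ c
    ... | yes refl = trans (lookup-splice-≮ p (q [ c ]≔ α) c≮m) (VecP.lookup∘update i q α)
    ... | no i≢c with pos i ℕ.<? m
    ...   | yes i<m = trans (lookup-splice-< p (q [ c ]≔ α) i<m) (sym (lookup-splice-< p q i<m))
    ...   | no i≮m = trans (lookup-splice-≮ p (q [ c ]≔ α) i≮m)
                           (trans (VecP.lookup∘update′ i≢c q α) (sym (lookup-splice-≮ p q i≮m)))

filter-cong : ∀ {A : Set} {f g : A → Bool} → (∀ x → f x ≡ g x) → ∀ xs →
  filter (λ x → f x Bool.≟ true) xs ≡ filter (λ x → g x Bool.≟ true) xs
filter-cong {f = f} {g} f≗g = ListP.filter-≐ (λ x → f x Bool.≟ true) (λ x → g x Bool.≟ true)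
  ((λ {x} fx → trans (sym (f≗g x)) fx) , (λ {x} gx → trans (f≗g x) gx))

-- Witnesses

module Main (k n′ : ℕ) (V : PointSet (suc n′)) (V⊆box : InBox k V)
            (σ : Permutation′ (suc n′)) (w : Monomial (suc n′)) where

  open Ordering σ

  cut : ℕ → Monomial n
  cut m = splice m 𝟙 w

  D : ℕ → PointSet n
  D m = downshifts k (applyDownFrom at m) V

  𝒰 : ℕ → PointSet n
  𝒰 m p = D m (splice m w p)

  fibre : ℕ → Vec ℕ n → List ℕ
  fibre m p = filter (λ α → 𝒰 m (p [ at m ]≔ α) Bool.≟ true) (upTo k)

  ∈-fibre⁻ : ∀ {m p α} → α ∈ fibre m p → 𝒰 m (p [ at m ]≔ α) ≡ true
  ∈-fibre⁻ {m} {p} = proj₂ ∘ ∈P.∈-filter⁻ (λ α → 𝒰 m (p [ at m ]≔ α) Bool.≟ true) {xs = upTo k}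

  ∈-fibre⁺ : ∀ {m p α} → α < k → 𝒰 m (p [ at m ]≔ α) ≡ true → α ∈ fibre m p
  ∈-fibre⁺ {m} {p} α<k = ∈P.∈-filter⁺ (λ α → 𝒰 m (p [ at m ]≔ α) Bool.≟ true) (∈P.∈-upTo⁺ α<k)

  cut-< : ∀ {m i} → pos i < m → lookup (cut m) i ≡ 0
  cut-< {i = i} i<m = trans (lookup-splice-< 𝟙 w i<m) (VecP.lookup-replicate i 0)

  cut-≮ : ∀ {m i} → ¬ pos i < m → lookup (cut m) i ≡ lookup w i
  cut-≮ = lookup-splice-≮ 𝟙 w

  cut-0 : cut 0 ≡ w
  cut-0 = splice-0 𝟙 w

  cut-n : cut n ≡ 𝟙
  cut-n = splice-n 𝟙 w

  module _ {m} (m<n : m < n) where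

    𝒰-suc : ∀ p → 𝒰 (suc m) p ≡ (lookup w (at m) ℕ.<ᵇ length (fibre m p))
    𝒰-suc p = cong₂ ℕ._<ᵇ_ (lookup-splice-< w p (at<1+ m<n)) (cong length (filter-cong reset (upTo k)))
      where
      c = at m
      reset : ∀ α → D m (splice (suc m) w p [ c ]≔ α) ≡ 𝒰 m (p [ c ]≔ α)
      reset α = cong (D m) (begin
        splice (suc m) w p [ c ]≔ α                  ≡⟨ cong (_[ c ]≔ α) (splice-suc m<n w p) ⟩
        splice m w p [ c ]≔ lookup w c [ c ]≔ α      ≡⟨ VecP.[]≔-idempotent (splice m w p) c ⟩
        splice m w p [ c ]≔ α                        ≡⟨ sym (splice-[]≔ w p c α (at≮ m<n)) ⟩
        splice m w (p [ c ]≔ α)                      ∎)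
        where open ≡-Reasoning

    fibre-large : ∀ p → 𝒰 (suc m) p ≡ true → lookup w (at m) < length (fibre m p)
    fibre-large p p∈𝒰 = ℕP.<ᵇ⇒< _ _ (subst T (trans (sym p∈𝒰) (𝒰-suc p)) tt)

    fibre-small : ∀ p → 𝒰 (suc m) p ≡ false → length (fibre m p) ≤ lookup w (at m)
    fibre-small p p∉𝒰 = ℕP.≮⇒≥ λ large → subst T (trans (sym (𝒰-suc p)) p∉𝒰) (ℕP.<⇒<ᵇ large)

  𝒰-local : ∀ m p q → (∀ i → ¬ pos i < m → lookup p i ≡ lookup q i) → 𝒰 m p ≡ 𝒰 m q
  𝒰-local m p q p≈q = cong (D m) (lookup-ext entry)
    where
    entry : ∀ i → lookup (splice m w p) i ≡ lookup (splice m w q) i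
    entry i with pos i ℕ.<? m
    ... | yes i<m = trans (lookup-splice-< w p i<m) (sym (lookup-splice-< w q i<m))
    ... | no i≮m = trans (lookup-splice-≮ w p i≮m) (trans (p≈q i i≮m) (sym (lookup-splice-≮ w q i≮m)))

  𝒰-0 : ∀ p → 𝒰 0 p ≡ V p
  𝒰-0 p = cong V (splice-0 w p)

  𝒰-grid : ∀ m p → 𝒰 m p ≡ true → ∀ i → ¬ pos i < m → lookup p i < k
  𝒰-grid zero p p∈𝒰 i _ = V⊆box p (trans (sym (𝒰-0 p)) p∈𝒰) i
  𝒰-grid (suc m) p p∈𝒰 i i≮m+1 = byRank (m ℕ.<? n)
    where
    byRank : Dec (m < n) → lookup p i < k
    byRank (no m≮n) = ⊥-elim (i≮m+1 (ℕP.<-≤-trans (pos<n i) (ℕP.≤-trans (ℕP.≮⇒≥ m≮n) (ℕP.n≤1+n m))))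
    byRank (yes m<n) with fibre m p | fibre-large m<n p p∈𝒰 | ∈-fibre⁻ {m} {p}
    ... | α ∷ _ | _ | ∈-fibre =
      subst (_< k) (VecP.lookup∘update′ i≢c p α)
        (𝒰-grid m (p [ at m ]≔ α) (∈-fibre (here refl)) i (i≮m+1 ∘ ℕP.m<n⇒m<1+n))
      where
      i≢c : i ≢ at m
      i≢c refl = i≮m+1 (at<1+ m<n)

  Vanishes : ℕ → Poly n → Set
  Vanishes m g = ∀ p → 𝒰 m p ≡ true → eval g (toℚⁿ p) ≡ 0ℚ

  Witness : ℕ → Poly n → Set
  Witness m g = Vanishes m g × AllMon (_⪯ cut m) g × coeff g (cut m) ≢ 0ℚ

  ⪯cut-< : ∀ {m u} → u ⪯ cut m → ∀ {i} → pos i < m → lookup u i ≡ 0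
  ⪯cut-< (inj₁ refl) i<m = cut-< i<m
  ⪯cut-< {m} {u} (inj₂ (i₀ , prefix , lt)) {i} i<m with pos i₀ ℕ.<? m
  ... | yes i₀<m = ⊥-elim (ℕP.n≮0 (subst (lookup u i₀ <_) (cut-< i₀<m) lt))
  ... | no i₀≮m = trans (prefix i (ℕP.<-≤-trans i<m (ℕP.≮⇒≥ i₀≮m))) (cut-< i<m)

  module _ {m} (m<n : m < n) where

    c : Fin n
    c = at m

    cut-c : lookup (cut m) c ≡ lookup w c
    cut-c = cut-≮ (at≮ m<n)

    cut-suc : cut (suc m) ≡ cut m [ c ]≔ 0
    cut-suc = trans (splice-suc m<n 𝟙 w) (cong (cut m [ c ]≔_) (VecP.lookup-replicate c 0))

    cut-unsuc : cut m ≡ cut (suc m) [ c ]≔ lookup w c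
    cut-unsuc = begin
      cut m                                  ≡⟨ sym (VecP.[]≔-lookup (cut m) c) ⟩
      cut m [ c ]≔ lookup (cut m) c          ≡⟨ cong (cut m [ c ]≔_) cut-c ⟩
      cut m [ c ]≔ lookup w c                ≡⟨ sym (VecP.[]≔-idempotent (cut m) c) ⟩
      cut m [ c ]≔ 0 [ c ]≔ lookup w c       ≡⟨ cong (_[ c ]≔ lookup w c) (sym cut-suc) ⟩
      cut (suc m) [ c ]≔ lookup w c          ∎
      where open ≡-Reasoning

    d : ℕ
    d = lookup w c

    ⪯cut-at : ∀ {u} → u ⪯ cut m → lookup u c ≤ d
    ⪯cut-at (inj₁ refl) = ℕP.≤-reflexive cut-c
    ⪯cut-at {u} (inj₂ (i₀ , prefix , lt)) with ℕ.<-cmp (pos i₀) m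
    ... | tri< i₀<m _ _ = ⊥-elim (ℕP.n≮0 (subst (lookup u i₀ <_) (cut-< i₀<m) lt))
    ... | tri≈ _ i₀≡m _ with pos-injective (trans i₀≡m (sym (pos-at m<n)))
    ...   | refl = ℕP.<⇒≤ (subst (lookup u c <_) cut-c lt)
    ⪯cut-at {u} (inj₂ (i₀ , prefix , lt)) | tri> _ _ m<i₀ =
      ℕP.≤-reflexive (trans (prefix c (subst (_< pos i₀) (sym (pos-at m<n)) m<i₀)) cut-c)

    ⪯cut-descend : ∀ {u} → u ⪯ cut m → lookup u c ≡ d → u [ c ]≔ 0 ⪯ cut (suc m)
    ⪯cut-descend (inj₁ refl) _ = inj₁ (sym cut-suc)
    ⪯cut-descend {u} (inj₂ u≺cut) uc≡d =
      inj₂ (subst (u [ c ]≔ 0 ≺_) (sym cut-suc) (≺-[]≔ {u} {cut m} c 0 u≺cut (trans uc≡d (sym cut-c))))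

    ⪯cut-ascend : ∀ {u} → u ⪯ cut (suc m) → u ⊕ x^ c d ⪯ cut m
    ⪯cut-ascend {u} u⪯cut = subst (_⪯ cut m) (sym (⊕-x^ u c d uc≡0)) (raise u⪯cut)
      where
      uc≡0 : lookup u c ≡ 0
      uc≡0 = ⪯cut-< u⪯cut (at<1+ m<n)
      raise : u ⪯ cut (suc m) → u [ c ]≔ d ⪯ cut m
      raise (inj₁ refl) = inj₁ (sym cut-unsuc)
      raise (inj₂ u≺cut) = inj₂ (subst (u [ c ]≔ d ≺_) (sym cut-unsuc)
        (≺-[]≔ {u} {cut (suc m)} c d u≺cut (trans uc≡0 (sym (cut-< (at<1+ m<n))))))

    descend : ∀ {f} → Witness m f → Witness (suc m) (partialCoeff c d f)
    descend {f} (f-vanishes , f⪯cut , f-lead) = vanishes , AllMon-partialCoeff c d f f⪯cut (λ _ → ⪯cut-descend) , lead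
      where
      vanishes : Vanishes (suc m) (partialCoeff c d f)
      vanishes q q∈𝒰 = top-coeff-vanishes d a (List.map toℚ (fibre m q))
        (UniqueP.map⁺ toℚ-injective (UniqueP.filter⁺ (λ α → 𝒰 m (q [ c ]≔ α) Bool.≟ true) (UniqueP.upTo⁺ k)))
        (subst (suc d ≤_) (sym (ListP.length-map toℚ (fibre m q))) (fibre-large m<n q q∈𝒰))
        λ s s∈ → let (α , α∈ , s≡α) = ∈P.∈-map⁻ toℚ s∈ in begin
          horner (suc d) a s             ≡⟨ cong (horner (suc d) a) s≡α ⟩
          horner (suc d) a (toℚ α)       ≡⟨ sym (eval-as-horner c d f (All.map ⪯cut-at f⪯cut) (toℚⁿ q) (toℚ α)) ⟩
          eval f (toℚⁿ q [ c ]≔ toℚ α)   ≡⟨ cong (eval f) (sym (VecP.map-[]≔ toℚ q c)) ⟩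
          eval f (toℚⁿ (q [ c ]≔ α))     ≡⟨ f-vanishes (q [ c ]≔ α) (∈-fibre⁻ {m} {q} α∈) ⟩
          0ℚ                             ∎
        where
        open ≡-Reasoning
        a : ℕ → ℚ
        a t = eval (partialCoeff c t f) (toℚⁿ q)
      lead : coeff (partialCoeff c d f) (cut (suc m)) ≢ 0ℚ
      lead = f-lead ∘ trans (cong (coeff f) cut-unsuc) ∘ trans (sym (coeff-partialCoeff c d f (cut (suc m)) (cut-< (at<1+ m<n))))

    Below : Monomial n → Set
    Below v = (∀ i → pos i < m → lookup v i ≡ 0) × lookup v c < d

    below⇒≺cut : ∀ {v} → Below v → v ≺ cut m
    below⇒≺cut {v} (v<m≡0 , vc<d) = c ,
      (λ i i<c → let i<m = subst (pos i <_) (pos-at m<n) i<c in trans (v<m≡0 i i<m) (sym (cut-< i<m))) ,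
      subst (lookup v c <_) (sym cut-c) vc<d

    ranksAbove : List (Fin n)
    ranksAbove = filter (λ i → m ℕ.<? pos i) (allFin n)

    ∈-ranksAbove⁻ : ∀ {i} → i ∈ ranksAbove → m < pos i
    ∈-ranksAbove⁻ = proj₂ ∘ ∈P.∈-filter⁻ (λ i → m ℕ.<? pos i) {xs = allFin n}

    ∈-ranksAbove⁺ : ∀ {i} → m < pos i → i ∈ ranksAbove
    ∈-ranksAbove⁺ {i} = ∈P.∈-filter⁺ (λ i → m ℕ.<? pos i) (∈P.∈-allFin i)

    correction : Vec ℕ n → Poly n
    correction p = rootCorrection c d (fibre m p)

    correction-local : DependsOnlyOn ranksAbove correction
    correction-local p q p≈q = cong (rootCorrection c d)
      (filter-cong (λ α → 𝒰-local m (p [ c ]≔ α) (q [ c ]≔ α) (agree α)) (upTo k))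
      where
      agree : ∀ α i → ¬ pos i < m → lookup (p [ c ]≔ α) i ≡ lookup (q [ c ]≔ α) i
      agree α i i≮m with i Fin.≟ c
      ... | yes refl = trans (VecP.lookup∘update i p α) (sym (VecP.lookup∘update i q α))
      ... | no i≢c = trans (VecP.lookup∘update′ i≢c p α)
        (trans (p≈q i (∈-ranksAbove⁺ (ℕP.≤∧≢⇒< (ℕP.≮⇒≥ i≮m) (i≢c ∘ pos-injective ∘ sym ∘ trans (pos-at m<n)))))
          (sym (VecP.lookup∘update′ i≢c q α)))

    open Interpolation k using (interpolate; eval-interpolate; AllMon-interpolate)

    X : Poly n
    X = term 1ℚ (x^ c d)

    -- R is chosen so that X + R vanishes on 𝒰 m ∖ 𝒰 (suc m).
    R : Poly n
    R = interpolate ranksAbove correction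

    R-below : AllMon Below R
    R-below = AllMon-interpolate ranksAbove correction correction-below closed
      where
      correction-below : ∀ p → AllMon Below (correction p)
      correction-below p = All.map (λ (pure , vc<d) → (λ i i<m → pure i (λ { refl → at≮ m<n i<m })) , vc<d)
                                   (rootCorrection-pureBelow c d (fibre m p))
      closed : ∀ j → j ∈ ranksAbove → ∀ u v → Pure j u → Below v → Below (u ⊕ v)
      closed j j∈ u v pure-u (v<m≡0 , vc<d) =
        (λ i i<m → trans (lookup-⊕ u v i) (cong₂ ℕ._+_ (pure-u i (λ { refl → ℕP.<-asym i<m j>m })) (v<m≡0 i i<m))) ,
        subst (_< d) (sym (trans (lookup-⊕ u v c) (cong (ℕ._+ lookup v c) (pure-u c c≢j)))) vc<d
        where
        j>m : m < pos j
        j>m = ∈-ranksAbove⁻ j∈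
        c≢j : c ≢ j
        c≢j refl = ℕP.<-irrefl (sym (pos-at m<n)) j>m

    X+R-vanishes : ∀ p → 𝒰 m p ≡ true → 𝒰 (suc m) p ≡ false → eval X (toℚⁿ p) + eval R (toℚⁿ p) ≡ 0ℚ
    X+R-vanishes p p∈𝒰 p∉𝒰′ = begin
      eval X a + eval R a
        ≡⟨ cong₂ _+_ (trans (eval-term 1ℚ (x^ c d) a) (trans (ℚP.*-identityˡ _) (evalMon-x^ a c d)))
                     (eval-interpolate ranksAbove correction correction-local p onGrid) ⟩
      pow (lookup a c) d + eval (correction p) a
        ≡⟨ ℚP.+-comm (pow (lookup a c) d) (eval (correction p) a) ⟩
      eval (correction p) a + pow (lookup a c) d
        ≡⟨ rootCorrection-cancels c d (fibre m p) a (lookup p c) (fibre-small m<n p p∉𝒰′) pc∈fibre (VecP.lookup-map c toℚ p) ⟩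
      0ℚ ∎
      where
      open ≡-Reasoning
      a = toℚⁿ p
      onGrid : ∀ i → i ∈ ranksAbove → lookup p i < k
      onGrid i i∈ = 𝒰-grid m p p∈𝒰 i (ℕP.<-asym (∈-ranksAbove⁻ i∈))
      pc∈fibre : lookup p c ∈ fibre m p
      pc∈fibre = ∈-fibre⁺ {m} {p} (𝒰-grid m p p∈𝒰 c (at≮ m<n)) (trans (cong (𝒰 m) (VecP.[]≔-lookup p c)) p∈𝒰)

    ascend : ∀ {g} → Witness (suc m) g → Witness m (g *ₚ X ++ g *ₚ R)
    ascend {g} (g-vanishes , g⪯cut , g-lead) =
      vanishes , AllMon-++ {f = g *ₚ X} {g = g *ₚ R} shifted⪯cut (All.map inj₂ rest≺cut) , lead
      where
      shifted⪯cut : AllMon (_⪯ cut m) (g *ₚ X)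
      shifted⪯cut = AllMon-*ₚ {Q = _≡ x^ c d} (λ { u v u⪯cut refl → ⪯cut-ascend u⪯cut }) {f = g} g⪯cut (refl ∷ [])

      rest≺cut : AllMon (_≺ cut m) (g *ₚ R)
      rest≺cut = AllMon-*ₚ (λ u v u⪯cut v-below → below⇒≺cut {u ⊕ v} (⊕-below u v u⪯cut v-below)) {f = g} g⪯cut R-below
        where
        ⊕-below : ∀ u v → u ⪯ cut (suc m) → Below v → Below (u ⊕ v)
        ⊕-below u v u⪯cut (v<m≡0 , vc<d) =
          (λ i i<m → trans (lookup-⊕ u v i) (cong₂ ℕ._+_ (⪯cut-< u⪯cut (ℕP.m<n⇒m<1+n i<m)) (v<m≡0 i i<m))) ,
          subst (_< d) (sym (trans (lookup-⊕ u v c) (cong (ℕ._+ lookup v c) (⪯cut-< u⪯cut (at<1+ m<n))))) vc<d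

      lead : coeff (g *ₚ X ++ g *ₚ R) (cut m) ≢ 0ℚ
      lead coeff≡0 = g-lead (begin
        coeff g (cut (suc m))                           ≡⟨ sym (coeff-*ₚ-monomial g (x^ c d) (cut (suc m))) ⟩
        coeff (g *ₚ X) (cut (suc m) ⊕ x^ c d)           ≡⟨ cong (coeff (g *ₚ X)) cut⊕x^≡cut ⟩
        coeff (g *ₚ X) (cut m)                          ≡⟨ sym (ℚP.+-identityʳ _) ⟩
        coeff (g *ₚ X) (cut m) + 0ℚ                     ≡⟨ cong (coeff (g *ₚ X) (cut m) +_) (sym rest-absent) ⟩
        coeff (g *ₚ X) (cut m) + coeff (g *ₚ R) (cut m) ≡⟨ sym (coeff-++ (g *ₚ X) (g *ₚ R) (cut m)) ⟩
        coeff (g *ₚ X ++ g *ₚ R) (cut m)                ≡⟨ coeff≡0 ⟩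
        0ℚ                                              ∎)
        where
        open ≡-Reasoning
        cut⊕x^≡cut : cut (suc m) ⊕ x^ c d ≡ cut m
        cut⊕x^≡cut = trans (⊕-x^ (cut (suc m)) c d (cut-< (at<1+ m<n))) (sym cut-unsuc)
        rest-absent : coeff (g *ₚ R) (cut m) ≡ 0ℚ
        rest-absent = coeff-absent (g *ₚ R) (cut m) (All.map (λ u≺cut u≡cut → ≺-irrefl {cut m} (subst (_≺ cut m) u≡cut u≺cut)) rest≺cut)

      vanishes : Vanishes m (g *ₚ X ++ g *ₚ R)
      vanishes p p∈𝒰 = begin
        eval (g *ₚ X ++ g *ₚ R) a                 ≡⟨ eval-++ (g *ₚ X) (g *ₚ R) a ⟩
        eval (g *ₚ X) a + eval (g *ₚ R) a         ≡⟨ cong₂ _+_ (eval-*ₚ g X a) (eval-*ₚ g R a) ⟩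
        eval g a * eval X a + eval g a * eval R a ≡⟨ sym (ℚP.*-distribˡ-+ (eval g a) (eval X a) (eval R a)) ⟩
        eval g a * (eval X a + eval R a)          ≡⟨ oneFactorVanishes (𝒰 (suc m) p) refl ⟩
        0ℚ                                        ∎
        where
        open ≡-Reasoning
        a = toℚⁿ p
        oneFactorVanishes : ∀ b → 𝒰 (suc m) p ≡ b → eval g a * (eval X a + eval R a) ≡ 0ℚ
        oneFactorVanishes true p∈𝒰′ =
          trans (cong (_* (eval X a + eval R a)) (g-vanishes p p∈𝒰′)) (ℚP.*-zeroˡ (eval X a + eval R a))
        oneFactorVanishes false p∉𝒰′ = trans (cong (eval g a *_) (X+R-vanishes p p∈𝒰 p∉𝒰′)) (ℚP.*-zeroʳ (eval g a))

  𝒰-n : ∀ p → 𝒰 n p ≡ D n w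
  𝒰-n p = cong (D n) (splice-n w p)

  witness-n⇒∉ : ∀ {f} → Witness n f → D n w ≡ true → ⊥
  witness-n⇒∉ {f} (f-vanishes , f⪯cut , f-lead) w∈D = f-lead (begin
    coeff f (cut n)               ≡⟨ cong (coeff f) cut-n ⟩
    coeff f 𝟙                     ≡⟨ sym (ℚP.*-identityʳ _) ⟩
    coeff f 𝟙 * 1ℚ                ≡⟨ cong (coeff f 𝟙 *_) (sym (evalMon-𝟙 (toℚⁿ w))) ⟩
    coeff f 𝟙 * evalMon (toℚⁿ w) 𝟙 ≡⟨ sym (eval-single-monomial f 𝟙 (toℚⁿ w) constant) ⟩
    eval f (toℚⁿ w)               ≡⟨ f-vanishes w (trans (𝒰-n w) w∈D) ⟩
    0ℚ                            ∎)
    where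
    open ≡-Reasoning
    constant : AllMon (_≡ 𝟙) f
    constant = All.map (λ u⪯cut → lookup-ext λ i → trans (⪯cut-< u⪯cut (pos<n i)) (sym (VecP.lookup-replicate i 0))) f⪯cut

  ∉⇒witness-n : D n w ≡ false → Witness n (term 1ℚ (cut n))
  ∉⇒witness-n w∉D = vanishes , inj₁ refl ∷ [] , λ 1≡0 → ℚP.1≢0 (trans (sym (coeff-term 1ℚ (cut n))) 1≡0)
    where
    vanishes : Vanishes n (term 1ℚ (cut n))
    vanishes p p∈𝒰 with trans (sym p∈𝒰) (trans (𝒰-n p) w∉D)
    ... | ()

  descend* : ∀ m → m ≤ n → ∃ (Witness 0) → ∃ (Witness m)
  descend* zero _ W = W
  descend* (suc m) m<n W = _ , descend m<n (proj₂ (descend* m (ℕP.<⇒≤ m<n) W))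

  ascend* : ∀ m → m ≤ n → ∃ (Witness m) → ∃ (Witness 0)
  ascend* zero _ W = W
  ascend* (suc m) m<n (g , Wg) = ascend* m (ℕP.<⇒≤ m<n) (_ , ascend m<n Wg)

  leading⇒witness-0 : ∀ {f} → InVanishingIdeal V f → IsLeadingMonomial σ f w → Witness 0 (normalise f)
  leading⇒witness-0 {f} f∈I (f-lead , f-top) = vanishes , All.map (⪯w _) (normalise-support f) , lead
    where
    vanishes : Vanishes 0 (normalise f)
    vanishes p p∈𝒰 = trans (eval-normalise f (toℚⁿ p)) (f∈I p (trans (sym (𝒰-0 p)) p∈𝒰))
    ⪯w : ∀ u → coeff f u ≢ 0ℚ → u ⪯ cut 0
    ⪯w u fu≢0 with ≺-trichotomy u w
    ... | inj₁ u≺w = inj₂ (subst (u ≺_) (sym cut-0) u≺w)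
    ... | inj₂ (inj₁ u≡w) = inj₁ (trans u≡w (sym cut-0))
    ... | inj₂ (inj₂ w≺u) = ⊥-elim (fu≢0 (f-top u (≺⇒LexLt {w} {u} w≺u)))
    lead : coeff (normalise f) (cut 0) ≢ 0ℚ
    lead = f-lead ∘ trans (sym (coeff-normalise f w)) ∘ trans (cong (coeff (normalise f)) (sym cut-0))

  witness-0⇒leading : ∀ {f} → Witness 0 f → InVanishingIdeal V f × IsLeadingMonomial σ f w
  witness-0⇒leading {f} (f-vanishes , f⪯cut , f-lead) =
    (λ p p∈V → f-vanishes p (trans (𝒰-0 p) p∈V)) ,
    f-lead ∘ trans (cong (coeff f) cut-0) ,
    λ u w≺u → coeff-above-max f (cut 0) f⪯cut u (subst (_≺ u) (sym cut-0) (LexLt⇒≺ {w} {u} w≺u))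

  standard⇔∈D : IsStandardMonomial σ V w ⇔ (D n w ≡ true)
  standard⇔∈D = mk⇔ to from
    where
    to : IsStandardMonomial σ V w → D n w ≡ true
    to standard with D n w in eq
    ... | true = refl
    ... | false = let (f , Wf) = ascend* n ℕP.≤-refl (_ , ∉⇒witness-n eq) in ⊥-elim (standard (f , witness-0⇒leading Wf))
    from : D n w ≡ true → IsStandardMonomial σ V w
    from w∈D (f , f∈I , f-leading) =
      witness-n⇒∉ (proj₂ (descend* n ℕP.≤-refl (_ , leading⇒witness-0 {f} f∈I f-leading))) w∈D

theorem2 : (k n : ℕ) → k ≥ 1 → n ≥ 1 → (V : PointSet n) → InBox k V →
    (σ : Permutation′ n) → (w : Monomial n) →
    IsStandardMonomial σ V w ⇔ (downshifts k (reversedOrder σ) V w ≡ true)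
theorem2 k zero _ () V V⊆box σ w
theorem2 k (suc n′) _ _ V V⊆box σ w =
  subst (λ js → IsStandardMonomial σ V w ⇔ (downshifts k js V w ≡ true))
    (sym (Ordering.reversedOrder≡ σ)) standard⇔∈D
  where open Main k n′ V V⊆box σ w
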